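{- Let $p$ be a prime with $p\equiv 1\pmod 4$, and let $a\in\mathbb{Z}$ with $p\nmid a$. Then $$\left|\left\{(j,k):\ 1\le j<k\le\tfrac{p-1}2,\ \{aj^2\}_p>\{ak^2\}_p\right\}\right|+\left|\left\{(j,k):\ 1\le j<k\le\tfrac{p-1}2,\ \{ak^2-aj^2\}_p>\tfrac p2\right\}\right|$$ $$\equiv\left|\left\{k\in\mathbb{Z}:\ 1\le k<\tfrac p4,\ \left(\tfrac kp\right)=\left(\tfrac ap\right)\right\}\right|\pmod 2.$$
   Context: For an integer $x$, $\{x\}_p$ denotes the least nonnegative residue of $x$ modulo $p$. $\left(\frac{\cdot}{p}\right)$ is the Legendre symbol. The pairs $(j,k)$ are ordered pairs of integers. -}

module Defs where

open import Data.Nat as ℕ using (ℕ; suc; _*_; _<_; _<ᵇ_; _≡ᵇ_; NonZero)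
open import Data.Nat.DivMod using (_%_)
open import Data.Integer as ℤ using (ℤ; +_; _%ℕ_)
open import Data.Bool using (Bool; true; false; _∧_; if_then_else_)
open import Data.List using (List; length; filterᵇ; upTo; cartesianProduct; map)
open import Data.Bool.ListAction using (any)
open import Data.Product using (_×_; _,_)

res : ℤ → (p : ℕ) → .{{NonZero p}} → ℕ
res x p = x %ℕ p

isSquareMod : (r p : ℕ) → .{{NonZero p}} → Bool
isSquareMod r p = any (λ x → ((x * x) % p) ≡ᵇ (r % p)) (upTo p)

legendre : ℤ → (p : ℕ) → .{{NonZero p}} → ℤ
legendre x p with res x p ≡ᵇ 0
... | true  = + 0
... | false = if isSquareMod (res x p) p then + 1 else ℤ.- (+ 1)

range1 : ℕ → List ℕ
range1 m = map suc (upTo m)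

pairsLt : ℕ → List (ℕ × ℕ)
pairsLt m = filterᵇ (λ { (j , k) → j <ᵇ k }) (cartesianProduct (range1 m) (range1 m))

ℤsq : ℕ → ℤ
ℤsq n = + (n * n)

count1 : ℤ → (p : ℕ) → .{{NonZero p}} → ℕ
count1 a p = length (filterᵇ
  (λ { (j , k) → res (a ℤ.* ℤsq k) p <ᵇ res (a ℤ.* ℤsq j) p })
  (pairsLt ((p ℕ.∸ 1) ℕ./ 2)))

count2 : ℤ → (p : ℕ) → .{{NonZero p}} → ℕ
count2 a p = length (filterᵇ
  (λ { (j , k) → p <ᵇ 2 * res (a ℤ.* ℤsq k ℤ.- a ℤ.* ℤsq j) p })
  (pairsLt ((p ℕ.∸ 1) ℕ./ 2)))

count3 : ℤ → (p : ℕ) → .{{NonZero p}} → ℕ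
count3 a p = length (filterᵇ
  (λ k → (4 * k <ᵇ p) ∧ ⌊ legendre (+ k) p ℤ.≟ legendre a p ⌋)
  (range1 p))
  where open import Relation.Nullary.Decidable using (⌊_⌋)

module Submission where

-- Let h = (p - 1)/2 and R i = {a i²}_p for 1 ≤ i ≤ h.  The R i are h distinct residues, all of
-- character (a/p); the case a = 1 shows that [1, p) holds exactly h squares and h non-squares, so
-- the R i are precisely the x ∈ [1, p) with (x/p) = (a/p).  For i < k, reducing R k - R i modulo p
-- adds p exactly when R k < R i, so [R k < R i] + [{R k - R i}_p > p/2] ≡ [|R k - R i| > p/2]
-- (mod 2), and the left-hand side counts, modulo 2, the pairs x < y of that set with y - x > p/2.
-- For p ≡ 1 (mod 4), -1 is a square (x ↦ x⁻¹ pairs up the h squares except ±1, and h is even), so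
-- the set is closed under x ↦ p - x, and (x, y) ↦ (p - y, p - x) pairs up those pairs except the
-- ones with x + y = p, i.e. (x, p - x) with 4x < p: these are what the right-hand side counts.

module Brackets where

  open import Data.Bool using (Bool; true; false; not; _∧_; T; if_then_else_)
  open import Data.Nat
  open import Data.Nat.Properties
  open import Data.Nat.Tactic.RingSolver using (solve-∀)
  open import Data.Product using (_×_; _,_)
  open import Data.Sum using (_⊎_; inj₁; inj₂; [_,_]′)
  open import Data.Empty using (⊥-elim)
  open import Function using (_∘_)
  open import Function.Bundles using (_⇔_; mk⇔; module Equivalence)
  open import Relation.Binary.PropositionalEquality
  open import Relation.Binary.Definitions using (tri<; tri≈; tri>)
  open import Relation.Nullary using (yes; no)
  open import Relation.Nullary.Decidable using (dec-true; dec-false; does-⇔)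

  ⟦_⟧ : Bool → ℕ
  ⟦ true ⟧ = 1
  ⟦ false ⟧ = 0

  ⟦⟧≤1 : ∀ b → ⟦ b ⟧ ≤ 1
  ⟦⟧≤1 true = ≤-refl
  ⟦⟧≤1 false = z≤n

  ⟦∧⟧ : ∀ b c → ⟦ b ∧ c ⟧ ≡ ⟦ b ⟧ * ⟦ c ⟧
  ⟦∧⟧ true true = refl
  ⟦∧⟧ true false = refl
  ⟦∧⟧ false _ = refl

  ⟦⟧+⟦not⟧ : ∀ b → ⟦ b ⟧ + ⟦ not b ⟧ ≡ 1
  ⟦⟧+⟦not⟧ true = refl
  ⟦⟧+⟦not⟧ false = refl

  ⟦⟧≡1⇒T : ∀ {b} → ⟦ b ⟧ ≡ 1 → T b
  ⟦⟧≡1⇒T {true} _ = _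

  <ᵇ-true : ∀ {m n} → m < n → (m <ᵇ n) ≡ true
  <ᵇ-true {m} {n} m<n = dec-true (m <? n) m<n

  <ᵇ-false : ∀ {m n} → n ≤ m → (m <ᵇ n) ≡ false
  <ᵇ-false {m} {n} n≤m = dec-false (m <? n) (≤⇒≯ n≤m)

  <ᵇ-cong-⇔ : ∀ {a b c d} → a < b ⇔ c < d → (a <ᵇ b) ≡ (c <ᵇ d)
  <ᵇ-cong-⇔ {a} {b} {c} {d} a<b⇔c<d = does-⇔ a<b⇔c<d (a <? b) (c <? d)

  +-≡-<-flip : ∀ {a b x y} → a + x ≡ b + y → a < b → y < x
  +-≡-<-flip e a<b = ≰⇒> (λ x≤y → <-irrefl e (+-mono-<-≤ a<b x≤y))

  +-≡-<-⇔ : ∀ a b x y → a + x ≡ b + y → a < b ⇔ y < x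
  +-≡-<-⇔ a b x y e =
    mk⇔ (+-≡-<-flip e) (+-≡-<-flip (trans (+-comm y b) (trans (sym e) (+-comm a x))))

  δ : ℕ → ℕ → ℕ
  δ m n = ⟦ m ≡ᵇ n ⟧

  δ-refl : ∀ n → δ n n ≡ 1
  δ-refl n = cong ⟦_⟧ (dec-true (n ≟ n) refl)

  δ-≡ : ∀ {m n} → m ≡ n → δ m n ≡ 1
  δ-≡ {m} refl = δ-refl m

  δ-≢ : ∀ {m n} → m ≢ n → δ m n ≡ 0
  δ-≢ {m} {n} m≢n = cong ⟦_⟧ (dec-false (m ≟ n) m≢n)

  δ-cong-⇔ : ∀ {a b c d} → a ≡ b ⇔ c ≡ d → δ a b ≡ δ c d
  δ-cong-⇔ {a} {b} {c} {d} a≡b⇔c≡d = cong ⟦_⟧ (does-⇔ a≡b⇔c≡d (a ≟ b) (c ≟ d))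

  δ-⊎ : ∀ {x y a b} → a ≢ b → x ≡ y ⇔ (y ≡ a ⊎ y ≡ b) → δ x y ≡ δ a y + δ b y
  δ-⊎ {x} {y} {a} {b} a≢b x≡y⇔ with y ≟ a | y ≟ b
  ... | yes refl | yes refl = ⊥-elim (a≢b refl)
  ... | yes refl | no y≢b = trans (δ-≡ (Equivalence.from x≡y⇔ (inj₁ refl)))
                                  (cong₂ _+_ (sym (δ-refl y)) (sym (δ-≢ (y≢b ∘ sym))))
  ... | no y≢a | yes refl = trans (δ-≡ (Equivalence.from x≡y⇔ (inj₂ refl)))
                                  (cong₂ _+_ (sym (δ-≢ (y≢a ∘ sym))) (sym (δ-refl y)))
  ... | no y≢a | no y≢b = trans (δ-≢ ([ y≢a , y≢b ]′ ∘ Equivalence.to x≡y⇔))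
                                (cong₂ _+_ (sym (δ-≢ (y≢a ∘ sym))) (sym (δ-≢ (y≢b ∘ sym))))

  δ+⟦<ᵇ⟧+⟦>ᵇ⟧ : ∀ m n → δ m n + ⟦ m <ᵇ n ⟧ + ⟦ n <ᵇ m ⟧ ≡ 1
  δ+⟦<ᵇ⟧+⟦>ᵇ⟧ m n with <-cmp m n
  ... | tri< m<n m≢n _ rewrite δ-≢ m≢n | <ᵇ-true m<n | <ᵇ-false (<⇒≤ m<n) = refl
  ... | tri≈ _ refl _ rewrite δ-refl m | <ᵇ-false (≤-refl {m}) = refl
  ... | tri> _ m≢n n<m rewrite δ-≢ m≢n | <ᵇ-true n<m | <ᵇ-false (<⇒≤ n<m) = refl

  trichotomy-* : ∀ x y g → δ x y * g + ⟦ x <ᵇ y ⟧ * g + ⟦ y <ᵇ x ⟧ * g ≡ g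
  trichotomy-* x y g = begin
    δ x y * g + ⟦ x <ᵇ y ⟧ * g + ⟦ y <ᵇ x ⟧ * g ≡⟨ cong (_+ ⟦ y <ᵇ x ⟧ * g) (*-distribʳ-+ g (δ x y) _) ⟨
    (δ x y + ⟦ x <ᵇ y ⟧) * g + ⟦ y <ᵇ x ⟧ * g   ≡⟨ *-distribʳ-+ g (δ x y + _) _ ⟨
    (δ x y + ⟦ x <ᵇ y ⟧ + ⟦ y <ᵇ x ⟧) * g       ≡⟨ cong (_* g) (δ+⟦<ᵇ⟧+⟦>ᵇ⟧ x y) ⟩
    1 * g                                       ≡⟨ *-identityˡ g ⟩
    g                                           ∎
    where open ≡-Reasoning

  ∣-∣-+-flip : ∀ a b x y → a + x ≡ b + y → ∣ a - b ∣ ≡ ∣ y - x ∣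
  ∣-∣-+-flip a b x y e = begin
    ∣ a - b ∣                             ≡⟨ ∣m+n-m+o∣≡∣n-o∣ (x + y) a b ⟨
    ∣ x + y + a - x + y + b ∣
      ≡⟨ cong₂ ∣_-_∣ (rearrange₁ x y a) (trans (rearrange₂ x y b) (cong (_+ x) (sym e))) ⟩
    ∣ (a + x) + y - (a + x) + x ∣         ≡⟨ ∣m+n-m+o∣≡∣n-o∣ (a + x) y x ⟩
    ∣ y - x ∣                             ∎
    where
    open ≡-Reasoning
    rearrange₁ : ∀ x y a → x + y + a ≡ a + x + y
    rearrange₁ = solve-∀
    rearrange₂ : ∀ x y b → x + y + b ≡ b + y + x
    rearrange₂ = solve-∀

  -- For odd p, a difference 0 < d < p is either short (2d < p) or long (2d > p), and
  -- passing to p ∸ d swaps the two.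
  ⟦>ᵇ⟧-wrap : ∀ p d → (∀ e → e + e ≢ p) → d ≤ p →
    1 + ⟦ p <ᵇ 2 * (p ∸ d) ⟧ ≡ ⟦ p <ᵇ 2 * d ⟧ + 2 * ⟦ 2 * d <ᵇ p ⟧
  ⟦>ᵇ⟧-wrap p d odd d≤p = begin
    1 + ⟦ p <ᵇ 2 * (p ∸ d) ⟧     ≡⟨ cong₂ (λ s b → s + ⟦ b ⟧) one≡ short≡long ⟨
    Short + Long + Short         ≡⟨ rearrange Short Long ⟩
    Long + 2 * Short             ∎
    where
    open ≡-Reasoning
    Short = ⟦ 2 * d <ᵇ p ⟧
    Long = ⟦ p <ᵇ 2 * d ⟧
    one≡ : Short + Long ≡ 1
    one≡ = trans (cong (λ t → t + Short + Long) (sym (δ-≢ (odd d ∘ trans (cong (d +_) (sym (+-identityʳ d)))))))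
                 (δ+⟦<ᵇ⟧+⟦>ᵇ⟧ (2 * d) p)
    short≡long : (2 * d <ᵇ p) ≡ (p <ᵇ 2 * (p ∸ d))
    short≡long = <ᵇ-cong-⇔ (+-≡-<-⇔ (2 * d) p (2 * (p ∸ d)) p (trans (sym (*-distribˡ-+ 2 d (p ∸ d)))
                                     (trans (cong (2 *_) (m+[n∸m]≡n d≤p)) (cong (p +_) (+-identityʳ p)))))
    rearrange : ∀ s l → s + l + s ≡ l + 2 * s
    rearrange = solve-∀

  -- r stands for the least residue of y - x modulo p.
  inversion+wrap : ∀ p x y r → (∀ e → e + e ≢ p) → x ≤ p →
    (x ≤ y → r ≡ y ∸ x) → (y < x → r ≡ p ∸ (x ∸ y)) →
    ⟦ y <ᵇ x ⟧ + ⟦ p <ᵇ 2 * r ⟧ ≡ ⟦ p <ᵇ 2 * ∣ x - y ∣ ⟧ + 2 * ⟦ (y <ᵇ x) ∧ (2 * (x ∸ y) <ᵇ p) ⟧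
  inversion+wrap p x y r odd x≤p r-≤ r-> with ≤-<-connex x y
  ... | inj₁ x≤y rewrite <ᵇ-false x≤y | r-≤ x≤y | m≤n⇒∣m-n∣≡n∸m x≤y = sym (+-identityʳ _)
  ... | inj₂ y<x rewrite <ᵇ-true y<x | r-> y<x | ∣-∣-comm x y | m≤n⇒∣m-n∣≡n∸m (<⇒≤ y<x) =
    ⟦>ᵇ⟧-wrap p (x ∸ y) odd (≤-trans (m∸n≤m x y) x≤p)

  ⟦<ᵇ⟧*⟦>ᵇ⟧-antidiagonal : ∀ p x y → x + y ≡ p → ⟦ x <ᵇ y ⟧ * ⟦ p <ᵇ 2 * ∣ x - y ∣ ⟧ ≡ ⟦ 4 * x <ᵇ p ⟧
  ⟦<ᵇ⟧*⟦>ᵇ⟧-antidiagonal p x y x+y≡p with <-≤-connex x y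
  ... | inj₁ x<y rewrite <ᵇ-true x<y | m≤n⇒∣m-n∣≡n∸m (<⇒≤ x<y) =
    trans (+-identityʳ _) (cong ⟦_⟧ (<ᵇ-cong-⇔ (+-≡-<-⇔ p (2 * k) p (4 * x) (begin
      p + p                           ≡⟨ cong₂ _+_ p≡ p≡ ⟩
      x + (x + k) + (x + (x + k))     ≡⟨ rearrange x k ⟩
      2 * k + 4 * x                   ∎))))
    where
    open ≡-Reasoning
    k = y ∸ x
    p≡ : p ≡ x + (x + k)
    p≡ = trans (sym x+y≡p) (cong (x +_) (sym (m+[n∸m]≡n (<⇒≤ x<y))))
    rearrange : ∀ x k → x + (x + k) + (x + (x + k)) ≡ 2 * k + 4 * x
    rearrange = solve-∀
  ... | inj₂ y≤x rewrite <ᵇ-false y≤x = sym (cong ⟦_⟧ (<ᵇ-false (begin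
    p             ≡⟨ x+y≡p ⟨
    x + y         ≤⟨ +-monoʳ-≤ x y≤x ⟩
    x + x         ≤⟨ m≤m+n (x + x) (x + x) ⟩
    x + x + (x + x) ≡⟨ rearrange x ⟩
    4 * x         ∎)))
    where
    open ≤-Reasoning
    rearrange : ∀ x → x + x + (x + x) ≡ 4 * x
    rearrange = solve-∀

  2*m≡1+b+2*k⇒b≡1 : ∀ m b k → b ≤ 1 → 2 * m ≡ 1 + b + 2 * k → b ≡ 1
  2*m≡1+b+2*k⇒b≡1 m zero k _ eq = ⊥-elim (even≢odd m k eq)
  2*m≡1+b+2*k⇒b≡1 m (suc zero) k _ _ = refl
  2*m≡1+b+2*k⇒b≡1 m (suc (suc _)) k (s≤s ()) _

  n≤1⇒n*n≡n : ∀ {n} → n ≤ 1 → n * n ≡ n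
  n≤1⇒n*n≡n z≤n = refl
  n≤1⇒n*n≡n (s≤s z≤n) = refl

  search : (ℕ → Bool) → ℕ → ℕ
  search f zero = 0
  search f (suc n) = if f 0 then 0 else suc (search (f ∘ suc) n)

  search-found : ∀ f n i → i < n → T (f i) → search f n < n × T (f (search f n))
  search-found f (suc n) i i<n fi with f 0 in f0
  ... | true = z<s , subst T (sym f0) _
  search-found f (suc n) zero _ fi | false = ⊥-elim (subst T f0 fi)
  search-found f (suc n) (suc i) (s<s i<n) fi | false with search-found (f ∘ suc) n i i<n fi
  ... | found<n , found = s<s found<n , found

module FiniteSums where

  open import Data.Bool using (Bool; true; false; not; _∧_)
  open import Data.Nat
  open import Data.Nat.Properties
  open import Data.Nat.Tactic.RingSolver using (solve-∀)
  open import Data.Product using (_×_; _,_)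
  open import Data.Sum using (inj₁; inj₂)
  open import Data.Empty using (⊥-elim)
  open import Data.List using (List; []; _∷_; _++_; length; filterᵇ; map; applyUpTo; cartesianProduct)
  open import Data.List.Properties using (map-applyUpTo)
  open import Function using (_∘_)
  open import Function.Bundles using (_⇔_; mk⇔)
  open import Relation.Binary.PropositionalEquality
  open import Relation.Nullary using (yes; no)
  open import Algebra.Properties.CommutativeSemigroup +-commutativeSemigroup
    using () renaming (interchange to +-interchange)
  open import Defs using (range1; pairsLt)
  open Brackets

  sum< : ℕ → (ℕ → ℕ) → ℕ
  sum< zero f = 0
  sum< (suc n) f = f 0 + sum< n (f ∘ suc)

  syntax sum< n (λ i → e) = ∑[ i < n ] e

  ∑-cong : ∀ n {f g : ℕ → ℕ} → (∀ i → i < n → f i ≡ g i) → ∑[ i < n ] f i ≡ ∑[ i < n ] g i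
  ∑-cong zero _ = refl
  ∑-cong (suc n) f≡g = cong₂ _+_ (f≡g 0 z<s) (∑-cong n (λ i i<n → f≡g (suc i) (s<s i<n)))

  ∑-zero : ∀ n (f : ℕ → ℕ) → (∀ i → i < n → f i ≡ 0) → ∑[ i < n ] f i ≡ 0
  ∑-zero zero _ _ = refl
  ∑-zero (suc n) f f≡0 = cong₂ _+_ (f≡0 0 z<s) (∑-zero n (f ∘ suc) (λ i i<n → f≡0 (suc i) (s<s i<n)))

  ∑-const : ∀ n c → ∑[ i < n ] c ≡ n * c
  ∑-const zero c = refl
  ∑-const (suc n) c = cong (c +_) (∑-const n c)

  ∑-+ : ∀ n (f g : ℕ → ℕ) → ∑[ i < n ] (f i + g i) ≡ ∑[ i < n ] f i + ∑[ i < n ] g i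
  ∑-+ zero f g = refl
  ∑-+ (suc n) f g = trans (cong (f 0 + g 0 +_) (∑-+ n (f ∘ suc) (g ∘ suc))) (+-interchange (f 0) (g 0) _ _)

  ∑-*ˡ : ∀ n c (f : ℕ → ℕ) → ∑[ i < n ] (c * f i) ≡ c * ∑[ i < n ] f i
  ∑-*ˡ zero c f = sym (*-zeroʳ c)
  ∑-*ˡ (suc n) c f = trans (cong (c * f 0 +_) (∑-*ˡ n c (f ∘ suc))) (sym (*-distribˡ-+ c (f 0) _))

  ∑-*ʳ : ∀ n c (f : ℕ → ℕ) → ∑[ i < n ] (f i * c) ≡ ∑[ i < n ] f i * c
  ∑-*ʳ n c f = trans (∑-cong n (λ i _ → *-comm (f i) c)) (trans (∑-*ˡ n c f) (*-comm c _))

  ∑⟦⟧+∑⟦not⟧ : ∀ n (b : ℕ → Bool) → ∑[ i < n ] ⟦ b i ⟧ + ∑[ i < n ] ⟦ not (b i) ⟧ ≡ n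
  ∑⟦⟧+∑⟦not⟧ n b = begin
    ∑[ i < n ] ⟦ b i ⟧ + ∑[ i < n ] ⟦ not (b i) ⟧  ≡⟨ ∑-+ n _ _ ⟨
    ∑[ i < n ] (⟦ b i ⟧ + ⟦ not (b i) ⟧)           ≡⟨ ∑-cong n (λ i _ → ⟦⟧+⟦not⟧ (b i)) ⟩
    ∑[ i < n ] 1                                  ≡⟨ ∑-const n 1 ⟩
    n * 1                                         ≡⟨ *-identityʳ n ⟩
    n                                             ∎
    where open ≡-Reasoning

  ∑-swap : ∀ m n (f : ℕ → ℕ → ℕ) → ∑[ i < m ] ∑[ j < n ] f i j ≡ ∑[ j < n ] ∑[ i < m ] f i j
  ∑-swap zero n f = sym (∑-zero n (λ _ → 0) (λ _ _ → refl))
  ∑-swap (suc m) n f = trans (cong (∑[ j < n ] f 0 j +_) (∑-swap m n (f ∘ suc))) (sym (∑-+ n (f 0) _))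

  ∑-mono-≤ : ∀ n {f g : ℕ → ℕ} → (∀ i → i < n → f i ≤ g i) → ∑[ i < n ] f i ≤ ∑[ i < n ] g i
  ∑-mono-≤ zero _ = z≤n
  ∑-mono-≤ (suc n) f≤g = +-mono-≤ (f≤g 0 z<s) (∑-mono-≤ n (λ i i<n → f≤g (suc i) (s<s i<n)))

  ∑-mono-≤-≡⇒≡ : ∀ n {f g : ℕ → ℕ} → (∀ i → i < n → f i ≤ g i) → ∑[ i < n ] f i ≡ ∑[ i < n ] g i →
    ∀ i → i < n → f i ≡ g i
  ∑-mono-≤-≡⇒≡ (suc n) {f} {g} f≤g ∑f≡∑g i i<sn = go i i<sn
    where
    tail≤ : ∀ i → i < n → f (suc i) ≤ g (suc i)
    tail≤ i i<n = f≤g (suc i) (s<s i<n)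
    head≡ : f 0 ≡ g 0
    head≡ with m≤n⇒m<n∨m≡n (f≤g 0 z<s)
    ... | inj₂ eq = eq
    ... | inj₁ lt = ⊥-elim (<⇒≢ (+-mono-<-≤ lt (∑-mono-≤ n tail≤)) ∑f≡∑g)
    go : ∀ i → i < suc n → f i ≡ g i
    go zero _ = head≡
    go (suc i) (s<s i<n) = ∑-mono-≤-≡⇒≡ n tail≤
      (+-cancelˡ-≡ (f 0) _ _ (trans ∑f≡∑g (cong (_+ _) (sym head≡)))) i i<n

  term≤∑ : ∀ n (f : ℕ → ℕ) i → i < n → f i ≤ ∑[ j < n ] f j
  term≤∑ (suc n) f zero _ = m≤m+n (f 0) _
  term≤∑ (suc n) f (suc i) (s<s i<n) = ≤-trans (term≤∑ n (f ∘ suc) i i<n) (m≤n+m _ (f 0))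

  ∑-suc : ∀ n (f : ℕ → ℕ) → ∑[ i < suc n ] f i ≡ ∑[ i < n ] f i + f n
  ∑-suc zero f = +-comm (f 0) 0
  ∑-suc (suc n) f = trans (cong (f 0 +_) (∑-suc n (f ∘ suc))) (sym (+-assoc (f 0) _ _))

  ∑-reverse : ∀ n (f : ℕ → ℕ) → ∑[ i < n ] f (n ∸ suc i) ≡ ∑[ i < n ] f i
  ∑-reverse zero f = refl
  ∑-reverse (suc n) f = begin
    f n + ∑[ i < n ] f (n ∸ suc i) ≡⟨ cong (f n +_) (∑-reverse n f) ⟩
    f n + ∑[ i < n ] f i           ≡⟨ +-comm (f n) _ ⟩
    ∑[ i < n ] f i + f n           ≡⟨ ∑-suc n f ⟨
    ∑[ i < suc n ] f i             ∎
    where open ≡-Reasoning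

  ∑-δ : ∀ n {m} (f : ℕ → ℕ) → m < n → ∑[ i < n ] (δ m i * f i) ≡ f m
  ∑-δ (suc n) {zero} f _ = trans (cong₂ _+_ (+-identityʳ (f 0)) (∑-zero n _ (λ _ _ → refl))) (+-identityʳ _)
  ∑-δ (suc n) {suc m} f (s<s m<n) = ∑-δ n (f ∘ suc) m<n

  ∑-δ₂ : ∀ n {a b} (f : ℕ → ℕ) → a < n → b < n → ∑[ i < n ] ((δ a i + δ b i) * f i) ≡ f a + f b
  ∑-δ₂ n {a} {b} f a<n b<n = trans (∑-cong n (λ i _ → *-distribʳ-+ (f i) (δ a i) (δ b i)))
                                   (trans (∑-+ n _ _) (cong₂ _+_ (∑-δ n f a<n) (∑-δ n f b<n)))

  InjectiveOn : ℕ → (ℕ → ℕ) → Set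
  InjectiveOn n R = ∀ i j → i < n → j < n → R i ≡ R j → i ≡ j

  MapsTo : ℕ → ℕ → (ℕ → ℕ) → Set
  MapsTo n M R = ∀ i → i < n → R i < M

  mult : ℕ → (ℕ → ℕ) → ℕ → ℕ
  mult n R x = ∑[ i < n ] δ (R i) x

  ∑-fibres : ∀ n M R (g : ℕ → ℕ) → MapsTo n M R →
    ∑[ i < n ] g (R i) ≡ ∑[ x < M ] (mult n R x * g x)
  ∑-fibres n M R g R<M = begin
    ∑[ i < n ] g (R i)                        ≡⟨ ∑-cong n (λ i i<n → ∑-δ M g (R<M i i<n)) ⟨
    ∑[ i < n ] ∑[ x < M ] (δ (R i) x * g x)   ≡⟨ ∑-swap n M (λ i x → δ (R i) x * g x) ⟩
    ∑[ x < M ] ∑[ i < n ] (δ (R i) x * g x)   ≡⟨ ∑-cong M (λ x _ → ∑-*ʳ n (g x) (λ i → δ (R i) x)) ⟩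
    ∑[ x < M ] (mult n R x * g x)             ∎
    where open ≡-Reasoning

  ∑-mult : ∀ n M R → MapsTo n M R → ∑[ x < M ] mult n R x ≡ n
  ∑-mult n M R R<M = begin
    ∑[ x < M ] mult n R x         ≡⟨ ∑-cong M (λ x _ → *-identityʳ (mult n R x)) ⟨
    ∑[ x < M ] (mult n R x * 1)   ≡⟨ ∑-fibres n M R (λ _ → 1) R<M ⟨
    ∑[ i < n ] 1                  ≡⟨ ∑-const n 1 ⟩
    n * 1                         ≡⟨ *-identityʳ n ⟩
    n                             ∎
    where open ≡-Reasoning

  mult-zero : ∀ n R x → (∀ i → i < n → R i ≢ x) → mult n R x ≡ 0
  mult-zero n R x R≢x = ∑-zero n _ (λ i i<n → δ-≢ (R≢x i i<n))

  mult-≤1 : ∀ n R x → InjectiveOn n R → mult n R x ≤ 1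
  mult-≤1 zero R x _ = z≤n
  mult-≤1 (suc n) R x inj with R n ≟ x
  ... | no Rn≢x = begin
    mult (suc n) R x       ≡⟨ ∑-suc n (λ i → δ (R i) x) ⟩
    mult n R x + δ (R n) x ≡⟨ cong (mult n R x +_) (δ-≢ Rn≢x) ⟩
    mult n R x + 0         ≡⟨ +-identityʳ _ ⟩
    mult n R x             ≤⟨ mult-≤1 n R x (λ i j i<n j<n → inj i j (m<n⇒m<1+n i<n) (m<n⇒m<1+n j<n)) ⟩
    1                      ∎
    where open ≤-Reasoning
  ... | yes refl = ≤-reflexive (begin
    mult (suc n) R (R n)          ≡⟨ ∑-suc n (λ i → δ (R i) (R n)) ⟩
    mult n R (R n) + δ (R n) (R n)
      ≡⟨ cong₂ _+_ (mult-zero n R (R n) (λ i i<n e → <⇒≢ i<n (inj i n (m<n⇒m<1+n i<n) ≤-refl e))) (δ-refl (R n)) ⟩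
    1                             ∎)
    where open ≡-Reasoning

  mult-image : ∀ n R i → InjectiveOn n R → i < n → mult n R (R i) ≡ 1
  mult-image n R i inj i<n = ≤-antisym (mult-≤1 n R (R i) inj)
    (≤-trans (≤-reflexive (sym (δ-refl (R i)))) (term≤∑ n (λ j → δ (R j) (R i)) i i<n))

  δ-injective : ∀ n R → InjectiveOn n R → ∀ i j → i < n → j < n → δ (R i) (R j) ≡ δ i j
  δ-injective n R inj i j i<n j<n with i ≟ j
  ... | yes refl = trans (δ-refl (R i)) (sym (δ-refl i))
  ... | no i≢j = trans (δ-≢ (i≢j ∘ inj i j i<n j<n)) (sym (δ-≢ i≢j))

  Involution : ℕ → (ℕ → ℕ) → Set
  Involution n J = MapsTo n n J × (∀ u → u < n → J (J u) ≡ u)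

  ∑-involution : ∀ n J (f : ℕ → ℕ) → Involution n J → ∑[ u < n ] f (J u) ≡ ∑[ u < n ] f u
  ∑-involution n J f (J<n , JJ) = begin
    ∑[ u < n ] f (J u)          ≡⟨ ∑-fibres n n J f J<n ⟩
    ∑[ x < n ] (mult n J x * f x) ≡⟨ ∑-cong n (λ x x<n → cong (_* f x) (mult-J x x<n)) ⟩
    ∑[ x < n ] (1 * f x)        ≡⟨ ∑-cong n (λ x _ → *-identityˡ (f x)) ⟩
    ∑[ x < n ] f x              ∎
    where
    open ≡-Reasoning
    J-injective : InjectiveOn n J
    J-injective u v u<n v<n Ju≡Jv = trans (sym (JJ u u<n)) (trans (cong J Ju≡Jv) (JJ v v<n))
    mult-J : ∀ x → x < n → mult n J x ≡ 1
    mult-J x x<n = subst (λ y → mult n J y ≡ 1) (JJ x x<n) (mult-image n J (J x) J-injective (J<n x x<n))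

  -- Off the fixed points of J the terms come in equal pairs f u = f (J u).
  ∑-involution-parity : ∀ n J (f : ℕ → ℕ) → Involution n J → (∀ u → u < n → f (J u) ≡ f u) →
    ∑[ u < n ] f u ≡ ∑[ u < n ] (δ (J u) u * f u) + 2 * ∑[ u < n ] (⟦ J u <ᵇ u ⟧ * f u)
  ∑-involution-parity n J f inv@(J<n , JJ) fJ≡f = begin
    ∑[ u < n ] f u                                      ≡⟨ ∑-cong n (λ u _ → trichotomy-* (J u) u (f u)) ⟨
    ∑[ u < n ] (δ (J u) u * f u + ⟦ J u <ᵇ u ⟧ * f u + ⟦ u <ᵇ J u ⟧ * f u)
      ≡⟨ trans (∑-+ n _ _) (cong₂ _+_ (∑-+ n _ _) upper≡lower) ⟩
    Fix + Below + Below                                 ≡⟨ +-assoc Fix Below Below ⟩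
    Fix + (Below + Below)                               ≡⟨ cong (λ t → Fix + (Below + t)) (+-identityʳ Below) ⟨
    Fix + 2 * Below                                     ∎
    where
    open ≡-Reasoning
    Fix = ∑[ u < n ] (δ (J u) u * f u)
    Below = ∑[ u < n ] (⟦ J u <ᵇ u ⟧ * f u)
    upper≡lower : ∑[ u < n ] (⟦ u <ᵇ J u ⟧ * f u) ≡ Below
    upper≡lower = begin
      ∑[ u < n ] (⟦ u <ᵇ J u ⟧ * f u)               ≡⟨ ∑-involution n J (λ u → ⟦ u <ᵇ J u ⟧ * f u) inv ⟨
      ∑[ u < n ] (⟦ J u <ᵇ J (J u) ⟧ * f (J u))
        ≡⟨ ∑-cong n (λ u u<n → cong₂ (λ v y → ⟦ J u <ᵇ v ⟧ * y) (JJ u u<n) (fJ≡f u u<n)) ⟩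
      Below                                         ∎

  ∑∑-+ : ∀ m n (f g : ℕ → ℕ → ℕ) →
    ∑[ i < m ] ∑[ j < n ] (f i j + g i j) ≡ ∑[ i < m ] ∑[ j < n ] f i j + ∑[ i < m ] ∑[ j < n ] g i j
  ∑∑-+ m n f g = trans (∑-cong m (λ i _ → ∑-+ n (f i) (g i))) (∑-+ m _ _)

  ∑∑-*ˡ : ∀ m n c (f : ℕ → ℕ → ℕ) → ∑[ i < m ] ∑[ j < n ] (c * f i j) ≡ c * ∑[ i < m ] ∑[ j < n ] f i j
  ∑∑-*ˡ m n c f = trans (∑-cong m (λ i _ → ∑-*ˡ n c (f i))) (∑-*ˡ m c _)

  ∑∑-fibres : ∀ n M (R : ℕ → ℕ) (G : ℕ → ℕ → ℕ) → MapsTo n M R →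
    ∑[ i < n ] ∑[ k < n ] G (R i) (R k) ≡ ∑[ x < M ] ∑[ y < M ] (mult n R x * mult n R y * G x y)
  ∑∑-fibres n M R G R<M = begin
    ∑[ i < n ] ∑[ k < n ] G (R i) (R k)                ≡⟨ ∑-cong n (λ i _ → ∑-fibres n M R (G (R i)) R<M) ⟩
    ∑[ i < n ] ∑[ y < M ] (c y * G (R i) y)            ≡⟨ ∑-swap n M (λ i y → c y * G (R i) y) ⟩
    ∑[ y < M ] ∑[ i < n ] (c y * G (R i) y)            ≡⟨ ∑-cong M (λ y _ → ∑-*ˡ n (c y) (λ i → G (R i) y)) ⟩
    ∑[ y < M ] (c y * ∑[ i < n ] G (R i) y)
      ≡⟨ ∑-cong M (λ y _ → cong (c y *_) (∑-fibres n M R (λ x → G x y) R<M)) ⟩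
    ∑[ y < M ] (c y * ∑[ x < M ] (c x * G x y))        ≡⟨ ∑-cong M (λ y _ → ∑-*ˡ M (c y) (λ x → c x * G x y)) ⟨
    ∑[ y < M ] ∑[ x < M ] (c y * (c x * G x y))        ≡⟨ ∑-swap M M (λ x y → c y * (c x * G x y)) ⟨
    ∑[ x < M ] ∑[ y < M ] (c y * (c x * G x y))        ≡⟨ ∑-cong M (λ x _ → ∑-cong M (λ y _ → reorder (c x) (c y) (G x y))) ⟩
    ∑[ x < M ] ∑[ y < M ] (c x * c y * G x y)          ∎
    where
    open ≡-Reasoning
    c = mult n R
    reorder : ∀ a b g → b * (a * g) ≡ a * b * g
    reorder a b g = trans (sym (*-assoc b a g)) (cong (_* g) (*-comm b a))

  ∑∑-drop-zero : ∀ n (c : ℕ → ℕ) (G : ℕ → ℕ → ℕ) → c 0 ≡ 0 →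
    ∑[ x < suc n ] ∑[ y < suc n ] (c x * c y * G x y)
      ≡ ∑[ u < n ] ∑[ v < n ] (c (suc u) * c (suc v) * G (suc u) (suc v))
  ∑∑-drop-zero n c G c0≡0 = cong₂ _+_
    (∑-zero (suc n) _ (λ y _ → cong (λ t → t * c y * G 0 y) c0≡0))
    (∑-cong n (λ u _ → cong (_+ ∑[ v < n ] (c (suc u) * c (suc v) * G (suc u) (suc v)))
      (trans (cong (λ t → c (suc u) * t * G (suc u) 0) c0≡0) (cong (_* G (suc u) 0) (*-zeroʳ (c (suc u)))))))

  ∑∑-trichotomy : ∀ n (R : ℕ → ℕ) (G : ℕ → ℕ → ℕ) → (∀ i k → G i k ≡ G k i) →
    ∑[ i < n ] ∑[ k < n ] (δ (R i) (R k) * G i k) + 2 * ∑[ i < n ] ∑[ k < n ] (⟦ R i <ᵇ R k ⟧ * G i k)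
      ≡ ∑[ i < n ] ∑[ k < n ] G i k
  ∑∑-trichotomy n R G G-sym = begin
    Diag + 2 * Below                ≡⟨ cong (λ t → Diag + (Below + t)) (+-identityʳ Below) ⟩
    Diag + (Below + Below)          ≡⟨ cong (λ t → Diag + (Below + t)) Below≡Above ⟩
    Diag + (Below + Above)          ≡⟨ +-assoc Diag Below Above ⟨
    Diag + Below + Above            ≡⟨ cong (_+ Above) (∑∑-+ n n _ _) ⟨
    ∑∑ (λ i k → δ (R i) (R k) * G i k + ⟦ R i <ᵇ R k ⟧ * G i k) + Above ≡⟨ ∑∑-+ n n _ _ ⟨
    ∑∑ (λ i k → δ (R i) (R k) * G i k + ⟦ R i <ᵇ R k ⟧ * G i k + ⟦ R k <ᵇ R i ⟧ * G i k)
      ≡⟨ ∑-cong n (λ i _ → ∑-cong n (λ k _ → trichotomy-* (R i) (R k) (G i k))) ⟩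
    ∑∑ G                            ∎
    where
    open ≡-Reasoning
    ∑∑ : (ℕ → ℕ → ℕ) → ℕ
    ∑∑ F = ∑[ i < n ] ∑[ k < n ] F i k
    Diag = ∑∑ (λ i k → δ (R i) (R k) * G i k)
    Below = ∑∑ (λ i k → ⟦ R i <ᵇ R k ⟧ * G i k)
    Above = ∑∑ (λ i k → ⟦ R k <ᵇ R i ⟧ * G i k)
    Below≡Above : Below ≡ Above
    Below≡Above = trans (∑-swap n n (λ i k → ⟦ R i <ᵇ R k ⟧ * G i k))
      (∑-cong n (λ k _ → ∑-cong n (λ i _ → cong (⟦ R i <ᵇ R k ⟧ *_) (G-sym i k))))

  ∑∑-<-injective : ∀ n (R : ℕ → ℕ) (G : ℕ → ℕ → ℕ) → InjectiveOn n R → (∀ i k → G i k ≡ G k i) →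
    ∑[ i < n ] ∑[ k < n ] (⟦ R i <ᵇ R k ⟧ * G i k) ≡ ∑[ i < n ] ∑[ k < n ] (⟦ i <ᵇ k ⟧ * G i k)
  ∑∑-<-injective n R G inj G-sym = *-cancelˡ-≡ _ _ 2 (+-cancelˡ-≡ Diag _ _ (begin
    Diag + 2 * ∑[ i < n ] ∑[ k < n ] (⟦ R i <ᵇ R k ⟧ * G i k) ≡⟨ ∑∑-trichotomy n R G G-sym ⟩
    ∑[ i < n ] ∑[ k < n ] G i k                              ≡⟨ ∑∑-trichotomy n (λ i → i) G G-sym ⟨
    Diag′ + 2 * ∑[ i < n ] ∑[ k < n ] (⟦ i <ᵇ k ⟧ * G i k)   ≡⟨ cong (_+ _) Diag≡Diag′ ⟨
    Diag + 2 * ∑[ i < n ] ∑[ k < n ] (⟦ i <ᵇ k ⟧ * G i k)    ∎))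
    where
    open ≡-Reasoning
    Diag = ∑[ i < n ] ∑[ k < n ] (δ (R i) (R k) * G i k)
    Diag′ = ∑[ i < n ] ∑[ k < n ] (δ i k * G i k)
    Diag≡Diag′ : Diag ≡ Diag′
    Diag≡Diag′ = ∑-cong n (λ i i<n → ∑-cong n (λ k k<n → cong (_* G i k) (δ-injective n R inj i k i<n k<n)))

  -- With x = u + 1, y = v + 1 and p = n + 1, the reflection (x, y) ↦ (p - y, p - x) swaps the pairs
  -- with x + y < p and those with x + y > p, and fixes those with x + y = p.
  ∑∑-reflection : ∀ n (F : ℕ → ℕ → ℕ) →
    (∀ u v → u < n → v < n → F (n ∸ suc v) (n ∸ suc u) ≡ F u v) →
    ∑[ u < n ] ∑[ v < n ] F u v
      ≡ ∑[ u < n ] F u (n ∸ suc u) + 2 * ∑[ u < n ] ∑[ v < n ] (⟦ suc (u + v) <ᵇ n ⟧ * F u v)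
  ∑∑-reflection n F F-reflect = begin
    ∑∑ F                     ≡⟨ ∑-cong n (λ u _ → ∑-cong n (λ v _ → trichotomy-* (suc (u + v)) n (F u v))) ⟨
    ∑∑ (λ u v → δ (suc (u + v)) n * F u v + ⟦ suc (u + v) <ᵇ n ⟧ * F u v + ⟦ n <ᵇ suc (u + v) ⟧ * F u v)
      ≡⟨ trans (∑∑-+ n n _ _) (cong (_+ Above) (∑∑-+ n n _ _)) ⟩
    OnDiag + Below + Above   ≡⟨ cong₂ (λ s t → s + Below + t) antidiagonal Above≡Below ⟩
    Anti + Below + Below     ≡⟨ +-assoc Anti Below Below ⟩
    Anti + (Below + Below)   ≡⟨ cong (λ t → Anti + (Below + t)) (+-identityʳ Below) ⟨
    Anti + 2 * Below         ∎
    where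
    open ≡-Reasoning
    ∑∑ : (ℕ → ℕ → ℕ) → ℕ
    ∑∑ F = ∑[ u < n ] ∑[ v < n ] F u v
    OnDiag = ∑∑ (λ u v → δ (suc (u + v)) n * F u v)
    Below = ∑∑ (λ u v → ⟦ suc (u + v) <ᵇ n ⟧ * F u v)
    Above = ∑∑ (λ u v → ⟦ n <ᵇ suc (u + v) ⟧ * F u v)
    Anti = ∑[ u < n ] F u (n ∸ suc u)
    n∸ : ℕ → ℕ
    n∸ u = n ∸ suc u
    on-antidiagonal : ∀ u v → u < n → suc (u + v) ≡ n ⇔ n∸ u ≡ v
    on-antidiagonal u v u<n = mk⇔ (λ e → trans (cong (_∸ suc u) (sym e)) (m+n∸m≡n (suc u) v))
                                  (λ e → trans (cong (suc u +_) (sym e)) (m+[n∸m]≡n u<n))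
    antidiagonal : OnDiag ≡ Anti
    antidiagonal = ∑-cong n (λ u u<n → trans
      (∑-cong n (λ v _ → cong (_* F u v) (δ-cong-⇔ (on-antidiagonal u v u<n))))
      (∑-δ n (F u) (∸-monoʳ-< z<s u<n)))
    Above≡Below : Above ≡ Below
    Above≡Below = begin
      Above                                    ≡⟨ ∑-reverse n (λ u → ∑[ v < n ] H u v) ⟨
      ∑[ u < n ] ∑[ v < n ] H (n∸ u) v          ≡⟨ ∑-cong n (λ u _ → ∑-reverse n (H (n∸ u))) ⟨
      ∑[ u < n ] ∑[ v < n ] H (n∸ u) (n∸ v)     ≡⟨ ∑-swap n n (λ u v → H (n∸ u) (n∸ v)) ⟩
      ∑[ u < n ] ∑[ v < n ] H (n∸ v) (n∸ u)     ≡⟨ ∑-cong n (λ u u<n → ∑-cong n (λ v v<n → reflected u v u<n v<n)) ⟩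
      Below                                    ∎
      where
      H : ℕ → ℕ → ℕ
      H u v = ⟦ n <ᵇ suc (u + v) ⟧ * F u v
      rearrange : ∀ a b u v → suc (a + b) + suc (u + v) ≡ (a + suc v) + (b + suc u)
      rearrange = solve-∀
      reflected : ∀ u v → u < n → v < n → H (n∸ v) (n∸ u) ≡ ⟦ suc (u + v) <ᵇ n ⟧ * F u v
      reflected u v u<n v<n = cong₂ (λ b x → ⟦ b ⟧ * x)
        (<ᵇ-cong-⇔ (+-≡-<-⇔ n (suc (n∸ v + n∸ u)) n (suc (u + v))
          (sym (trans (rearrange (n∸ v) (n∸ u) u v) (cong₂ _+_ (m∸n+n≡m v<n) (m∸n+n≡m u<n))))))
        (F-reflect u v u<n v<n)

  count : ∀ {A : Set} → (A → Bool) → List A → ℕ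
  count P xs = length (filterᵇ P xs)

  count-∷ : ∀ {A : Set} (P : A → Bool) x xs → count P (x ∷ xs) ≡ ⟦ P x ⟧ + count P xs
  count-∷ P x xs with P x
  ... | true = refl
  ... | false = refl

  count-++ : ∀ {A : Set} (P : A → Bool) xs ys → count P (xs ++ ys) ≡ count P xs + count P ys
  count-++ P [] ys = refl
  count-++ P (x ∷ xs) ys = begin
    count P (x ∷ xs ++ ys)                   ≡⟨ count-∷ P x (xs ++ ys) ⟩
    ⟦ P x ⟧ + count P (xs ++ ys)             ≡⟨ cong (⟦ P x ⟧ +_) (count-++ P xs ys) ⟩
    ⟦ P x ⟧ + (count P xs + count P ys)      ≡⟨ +-assoc ⟦ P x ⟧ _ _ ⟨
    ⟦ P x ⟧ + count P xs + count P ys        ≡⟨ cong (_+ count P ys) (count-∷ P x xs) ⟨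
    count P (x ∷ xs) + count P ys            ∎
    where open ≡-Reasoning

  count-map : ∀ {A B : Set} (P : B → Bool) (f : A → B) xs → count P (map f xs) ≡ count (P ∘ f) xs
  count-map P f [] = refl
  count-map P f (x ∷ xs) = begin
    count P (f x ∷ map f xs)         ≡⟨ count-∷ P (f x) (map f xs) ⟩
    ⟦ P (f x) ⟧ + count P (map f xs) ≡⟨ cong (⟦ P (f x) ⟧ +_) (count-map P f xs) ⟩
    ⟦ P (f x) ⟧ + count (P ∘ f) xs   ≡⟨ count-∷ (P ∘ f) x xs ⟨
    count (P ∘ f) (x ∷ xs)           ∎
    where open ≡-Reasoning

  count-filterᵇ : ∀ {A : Set} (P Q : A → Bool) xs → count Q (filterᵇ P xs) ≡ count (λ x → P x ∧ Q x) xs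
  count-filterᵇ P Q [] = refl
  count-filterᵇ P Q (x ∷ xs) = begin
    count Q (filterᵇ P (x ∷ xs))              ≡⟨ head ⟩
    ⟦ P x ∧ Q x ⟧ + count Q (filterᵇ P xs)    ≡⟨ cong (⟦ P x ∧ Q x ⟧ +_) (count-filterᵇ P Q xs) ⟩
    ⟦ P x ∧ Q x ⟧ + count (λ y → P y ∧ Q y) xs ≡⟨ count-∷ (λ y → P y ∧ Q y) x xs ⟨
    count (λ y → P y ∧ Q y) (x ∷ xs)          ∎
    where
    open ≡-Reasoning
    head : count Q (filterᵇ P (x ∷ xs)) ≡ ⟦ P x ∧ Q x ⟧ + count Q (filterᵇ P xs)
    head with P x
    ... | true = count-∷ Q x _
    ... | false = refl

  count-applyUpTo : ∀ {A : Set} (P : A → Bool) (f : ℕ → A) n → count P (applyUpTo f n) ≡ ∑[ i < n ] ⟦ P (f i) ⟧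
  count-applyUpTo P f zero = refl
  count-applyUpTo P f (suc n) = trans (count-∷ P (f 0) _) (cong (⟦ P (f 0) ⟧ +_) (count-applyUpTo P (f ∘ suc) n))

  count-cartesianProduct : ∀ {B : Set} (P : ℕ × B → Bool) (f : ℕ → ℕ) n ys →
    count P (cartesianProduct (applyUpTo f n) ys) ≡ ∑[ i < n ] count (λ y → P (f i , y)) ys
  count-cartesianProduct P f zero ys = refl
  count-cartesianProduct P f (suc n) ys = trans (count-++ P (map (f 0 ,_) ys) _)
    (cong₂ _+_ (count-map P (f 0 ,_) ys) (count-cartesianProduct P (f ∘ suc) n ys))

  count-range1 : ∀ (P : ℕ → Bool) n → count P (range1 n) ≡ ∑[ i < n ] ⟦ P (suc i) ⟧
  count-range1 P n = trans (cong (count P) (map-applyUpTo (λ i → i) suc n)) (count-applyUpTo P suc n)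

  count-pairsLt : ∀ (P : ℕ × ℕ → Bool) n →
    count P (pairsLt n) ≡ ∑[ i < n ] ∑[ k < n ] (⟦ i <ᵇ k ⟧ * ⟦ P (suc i , suc k) ⟧)
  count-pairsLt P n = begin
    count P (pairsLt n)
      ≡⟨ count-filterᵇ _ P (cartesianProduct (range1 n) (range1 n)) ⟩
    count P< (cartesianProduct (range1 n) (range1 n))
      ≡⟨ cong (λ xs → count P< (cartesianProduct xs xs)) (map-applyUpTo (λ i → i) suc n) ⟩
    count P< (cartesianProduct (applyUpTo suc n) (applyUpTo suc n)) ≡⟨ count-cartesianProduct P< suc n _ ⟩
    ∑[ i < n ] count (λ y → P< (suc i , y)) (applyUpTo suc n)       ≡⟨ ∑-cong n (λ i _ → count-applyUpTo _ suc n) ⟩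
    ∑[ i < n ] ∑[ k < n ] ⟦ (i <ᵇ k) ∧ P (suc i , suc k) ⟧          ≡⟨ ∑-cong n (λ i _ → ∑-cong n (λ k _ → ⟦∧⟧ (i <ᵇ k) _)) ⟩
    ∑[ i < n ] ∑[ k < n ] (⟦ i <ᵇ k ⟧ * ⟦ P (suc i , suc k) ⟧)      ∎
    where
    open ≡-Reasoning
    P< : ℕ × ℕ → Bool
    P< (j , k) = (j <ᵇ k) ∧ P (j , k)

module Congruences where

  open import Data.Nat as ℕ using (ℕ; zero; suc; z≤n; NonZero)
  import Data.Nat.Properties as ℕ
  import Data.Nat.Divisibility as ℕ
  open import Data.Nat.DivMod using (m<n⇒m%n≡m)
  open import Data.Nat.Primality using (Prime; euclidsLemma; prime⇒nonZero)
  open import Data.Nat.Coprimality using (prime⇒coprime; coprime-Bézout)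
  open import Data.Nat.GCD using (module Bézout)
  open import Data.Integer as ℤ using (ℤ; +_; _+_; _*_; -_; _-_; ∣_∣; _/ℕ_)
  import Data.Integer.Properties as ℤ
  open import Data.Integer.Divisibility.Signed
    using (_∣_; divides; ∣m∣n⇒∣m+n; ∣m⇒∣-m; ∣m⇒∣m*n; ∣n⇒∣m*n; ∣⇒∣ᵤ; ∣ᵤ⇒∣)
  open import Data.Integer.DivMod using (a≡a%ℕn+[a/ℕn]*n; n%ℕd<d)
  open import Data.Integer.Tactic.RingSolver using (solve-∀)
  open import Data.Product using (∃; _,_)
  open import Data.Sum using (_⊎_; inj₁; inj₂)
  open import Data.Empty using (⊥-elim)
  open import Function.Bundles using (_⇔_; mk⇔; module Equivalence)
  open import Relation.Binary.Bundles using (Setoid)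
  open import Relation.Binary.PropositionalEquality
  open import Relation.Nullary using (¬_)
  open import Defs using (res)

  module Congruence (p : ℕ) where

    infix 4 _≈_ _≉_

    -- A record rather than + p ∣ x - y itself, so that x and y are inferable from a proof.
    record _≈_ (x y : ℤ) : Set where
      constructor mk≈
      field p∣x-y : + p ∣ x - y

    open _≈_ public

    _≉_ : ℤ → ℤ → Set
    x ≉ y = ¬ (x ≈ y)

    private
      by : ∀ {x y z} → x - y ≡ z → + p ∣ z → x ≈ y
      by x-y≡z p∣z = mk≈ (subst (+ p ∣_) (sym x-y≡z) p∣z)

    ≈-reflexive : ∀ {x y} → x ≡ y → x ≈ y
    ≈-reflexive {x} refl = by (ℤ.+-inverseʳ x) (divides (+ 0) refl)

    ≈-refl : ∀ {x} → x ≈ x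
    ≈-refl = ≈-reflexive refl

    ≈-sym : ∀ {x y} → x ≈ y → y ≈ x
    ≈-sym {x} {y} x≈y = by (identity x y) (∣m⇒∣-m (p∣x-y x≈y))
      where
      identity : ∀ x y → y - x ≡ - (x - y)
      identity = solve-∀

    ≈-trans : ∀ {x y z} → x ≈ y → y ≈ z → x ≈ z
    ≈-trans {x} {y} {z} x≈y y≈z = by (identity x y z) (∣m∣n⇒∣m+n (p∣x-y x≈y) (p∣x-y y≈z))
      where
      identity : ∀ x y z → x - z ≡ (x - y) + (y - z)
      identity = solve-∀

    ≈-setoid : Setoid _ _
    ≈-setoid = record
      { Carrier = ℤ
      ; _≈_ = _≈_
      ; isEquivalence = record { refl = ≈-refl ; sym = ≈-sym ; trans = ≈-trans }
      }

    +-cong : ∀ {a b c d} → a ≈ b → c ≈ d → a + c ≈ b + d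
    +-cong {a} {b} {c} {d} a≈b c≈d = by (identity a b c d) (∣m∣n⇒∣m+n (p∣x-y a≈b) (p∣x-y c≈d))
      where
      identity : ∀ a b c d → (a + c) - (b + d) ≡ (a - b) + (c - d)
      identity = solve-∀

    *-cong : ∀ {a b c d} → a ≈ b → c ≈ d → a * c ≈ b * d
    *-cong {a} {b} {c} {d} a≈b c≈d =
      by (identity a b c d) (∣m∣n⇒∣m+n (∣m⇒∣m*n c (p∣x-y a≈b)) (∣n⇒∣m*n b (p∣x-y c≈d)))
      where
      identity : ∀ a b c d → a * c - b * d ≡ (a - b) * c + b * (c - d)
      identity = solve-∀

    -‿cong : ∀ {a b} → a ≈ b → - a ≈ - b
    -‿cong {a} {b} a≈b = by (identity a b) (∣m⇒∣-m (p∣x-y a≈b))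
      where
      identity : ∀ a b → - a - - b ≡ - (a - b)
      identity = solve-∀

    ≈0⇔∣ : ∀ {x} → x ≈ + 0 ⇔ + p ∣ x
    ≈0⇔∣ {x} = mk⇔ (λ x≈0 → subst (+ p ∣_) (ℤ.+-identityʳ x) (p∣x-y x≈0))
                   (λ p∣x → mk≈ (subst (+ p ∣_) (sym (ℤ.+-identityʳ x)) p∣x))

    ≈⇒-≈0 : ∀ {x y} → x ≈ y → x - y ≈ + 0
    ≈⇒-≈0 x≈y = Equivalence.from ≈0⇔∣ (p∣x-y x≈y)

    -≈0⇒≈ : ∀ {x y} → x - y ≈ + 0 → x ≈ y
    -≈0⇒≈ x-y≈0 = mk≈ (Equivalence.to ≈0⇔∣ x-y≈0)

    p≈0 : + p ≈ + 0
    p≈0 = mk≈ (divides (+ 1) (trans (ℤ.+-identityʳ (+ p)) (sym (ℤ.*-identityˡ (+ p)))))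

    +[a+b*p]≈a : ∀ a b → + (a ℕ.+ b ℕ.* p) ≈ + a
    +[a+b*p]≈a a b = by (trans (cong (_- + a) (ℤ.pos-+ a (b ℕ.* p)))
                               (trans (identity (+ a) (+ (b ℕ.* p))) (ℤ.pos-* b p)))
                        (divides (+ b) refl)
      where
      identity : ∀ x y → (x + y) - x ≡ y
      identity = solve-∀

  module Residue (p : ℕ) .{{_ : NonZero p}} where

    open Congruence p

    res<p : ∀ x → res x p ℕ.< p
    res<p x = n%ℕd<d x p

    res-≈ : ∀ x → + res x p ≈ x
    res-≈ x = ≈-sym (mk≈ (divides (x /ℕ p) (begin
      x - + res x p                            ≡⟨ cong (_- + res x p) (a≡a%ℕn+[a/ℕn]*n x p) ⟩
      + res x p + x /ℕ p * + p - + res x p     ≡⟨ identity (+ res x p) (x /ℕ p * + p) ⟩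
      x /ℕ p * + p                             ∎)))
      where
      open ≡-Reasoning
      identity : ∀ r y → r + y - r ≡ y
      identity = solve-∀

    res-of-< : ∀ {n} → n ℕ.< p → res (+ n) p ≡ n
    res-of-< = m<n⇒m%n≡m

    ≤-≈⇒≡ : ∀ {r s} → s ℕ.≤ r → r ℕ.< p → + r ≈ + s → r ≡ s
    ≤-≈⇒≡ {r} {s} s≤r r<p r≈s = ℕ.≤-antisym (ℕ.m∸n≡0⇒m≤n r∸s≡0) s≤r
      where
      p∣r∸s : p ℕ.∣ r ℕ.∸ s
      p∣r∸s = subst (p ℕ.∣_) (cong ∣_∣ (trans (ℤ.m-n≡m⊖n r s) (ℤ.⊖-≥ s≤r))) (∣⇒∣ᵤ (p∣x-y r≈s))
      r∸s≡0 : r ℕ.∸ s ≡ 0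
      r∸s≡0 with r ℕ.∸ s in eq
      ... | zero = refl
      ... | suc d = ⊥-elim (ℕ.<⇒≱ (subst (ℕ._< p) eq (ℕ.≤-<-trans (ℕ.m∸n≤m r s) r<p))
                                    (ℕ.∣⇒≤ (subst (p ℕ.∣_) eq p∣r∸s)))

    <-≈⇒≡ : ∀ {r s} → r ℕ.< p → s ℕ.< p → + r ≈ + s → r ≡ s
    <-≈⇒≡ {r} {s} r<p s<p r≈s with ℕ.≤-total s r
    ... | inj₁ s≤r = ≤-≈⇒≡ s≤r r<p r≈s
    ... | inj₂ r≤s = sym (≤-≈⇒≡ r≤s s<p (≈-sym r≈s))

    res-cong : ∀ {x y} → x ≈ y → res x p ≡ res y p
    res-cong {x} {y} x≈y = <-≈⇒≡ (res<p x) (res<p y) (≈-trans (res-≈ x) (≈-trans x≈y (≈-sym (res-≈ y))))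

    res-injective : ∀ {x y} → res x p ≡ res y p → x ≈ y
    res-injective {x} {y} eq = ≈-trans (≈-sym (res-≈ x)) (subst (λ r → + r ≈ y) (sym eq) (res-≈ y))

    p∸n≈-n : ∀ n → n ℕ.≤ p → + (p ℕ.∸ n) ≈ - + n
    p∸n≈-n n n≤p = begin
      + (p ℕ.∸ n)  ≡⟨ trans (sym (ℤ.⊖-≥ n≤p)) (sym (ℤ.m-n≡m⊖n p n)) ⟩
      + p - + n    ≈⟨ +-cong p≈0 (≈-refl { - + n}) ⟩
      + 0 - + n    ≡⟨ ℤ.+-identityˡ (- + n) ⟩
      - + n        ∎
      where open import Relation.Binary.Reasoning.Setoid ≈-setoid

    res-difference-≤ : ∀ {x y} → x ℕ.≤ y → y ℕ.< p → res (+ y - + x) p ≡ y ℕ.∸ x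
    res-difference-≤ {x} {y} x≤y y<p = trans (cong (λ z → res z p) (trans (ℤ.m-n≡m⊖n y x) (ℤ.⊖-≥ x≤y)))
                                             (res-of-< (ℕ.≤-<-trans (ℕ.m∸n≤m y x) y<p))

    res-difference-> : ∀ {x y} → y ℕ.< x → x ℕ.< p → res (+ y - + x) p ≡ p ℕ.∸ (x ℕ.∸ y)
    res-difference-> {x} {y} y<x x<p = trans (res-cong (begin
      + y - + x          ≡⟨ trans (ℤ.m-n≡m⊖n y x) (ℤ.⊖-< y<x) ⟩
      - + d              ≈⟨ p∸n≈-n d d≤p ⟨
      + (p ℕ.∸ d)        ∎)) (res-of-< (ℕ.∸-monoʳ-< (ℕ.m<n⇒0<n∸m y<x) d≤p))
      where
      open import Relation.Binary.Reasoning.Setoid ≈-setoid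
      d = x ℕ.∸ y
      d≤p : d ℕ.≤ p
      d≤p = ℕ.≤-trans (ℕ.m∸n≤m x y) (ℕ.<⇒≤ x<p)

  module PrimeModulus (p : ℕ) (prime : Prime p) where

    private instance
      p≢0 : NonZero p
      p≢0 = prime⇒nonZero prime

    open Congruence p
    open Residue p

    ≈0-* : ∀ x y → x * y ≈ + 0 → x ≈ + 0 ⊎ y ≈ + 0
    ≈0-* x y xy≈0 with euclidsLemma ∣ x ∣ ∣ y ∣ prime
                         (subst (p ℕ.∣_) (ℤ.abs-* x y) (∣⇒∣ᵤ (Equivalence.to ≈0⇔∣ xy≈0)))
    ... | inj₁ p∣x = inj₁ (Equivalence.from ≈0⇔∣ (∣ᵤ⇒∣ p∣x))
    ... | inj₂ p∣y = inj₂ (Equivalence.from ≈0⇔∣ (∣ᵤ⇒∣ p∣y))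

    ≉0-* : ∀ {x y} → x ≉ + 0 → y ≉ + 0 → x * y ≉ + 0
    ≉0-* {x} {y} x≉0 y≉0 xy≈0 with ≈0-* x y xy≈0
    ... | inj₁ x≈0 = x≉0 x≈0
    ... | inj₂ y≈0 = y≉0 y≈0

    <p⇒≉0 : ∀ {n} → 0 ℕ.< n → n ℕ.< p → + n ≉ + 0
    <p⇒≉0 {n} 0<n n<p n≈0 = ℕ.<⇒≢ 0<n (sym (<-≈⇒≡ n<p (ℕ.≤-<-trans z≤n n<p) n≈0))

    res≢0 : ∀ {x} → x ≉ + 0 → res x p ≢ 0
    res≢0 {x} x≉0 r≡0 = x≉0 (≈-trans (≈-sym (res-≈ x)) (≈-reflexive (cong +_ r≡0)))

    private
      bézout-inverse : ∀ x → x ≉ + 0 → ∃ λ y → x * y ≈ + 1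
      bézout-inverse x x≉0 = from-Bézout (coprime-Bézout (prime⇒coprime prime {{r≢0}} (res<p x)))
        where
        r : ℕ
        r = res x p
        r≢0 : NonZero r
        r≢0 = ℕ.≢-nonZero (res≢0 x≉0)
        x≈r : x ≈ + r
        x≈r = ≈-sym (res-≈ x)
        from-Bézout : Bézout.Identity 1 p r → ∃ λ y → x * y ≈ + 1
        from-Bézout (Bézout.-+ u v eq) = + v , (begin
          x * + v          ≈⟨ *-cong x≈r ≈-refl ⟩
          + r * + v        ≡⟨ trans (sym (ℤ.pos-* r v)) (cong +_ (ℕ.*-comm r v)) ⟩
          + (v ℕ.* r)      ≡⟨ cong +_ eq ⟨
          + (1 ℕ.+ u ℕ.* p) ≈⟨ +[a+b*p]≈a 1 u ⟩
          + 1              ∎)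
          where open import Relation.Binary.Reasoning.Setoid ≈-setoid
        from-Bézout (Bézout.+- u v eq) = - + v , (begin
          x * - + v                   ≈⟨ *-cong x≈r ≈-refl ⟩
          + r * - + v                 ≡⟨ identity (+ r) (+ v) ⟩
          + 1 - (+ 1 + + v * + r)     ≡⟨ cong (λ t → + 1 - (+ 1 + t)) (ℤ.pos-* v r) ⟨
          + 1 - (+ 1 + + (v ℕ.* r))   ≡⟨ cong (λ t → + 1 - t) (ℤ.pos-+ 1 (v ℕ.* r)) ⟨
          + 1 - + (1 ℕ.+ v ℕ.* r)     ≡⟨ cong (λ t → + 1 - + t) eq ⟩
          + 1 - + (u ℕ.* p)           ≈⟨ +-cong (≈-refl {+ 1}) (-‿cong (+[a+b*p]≈a 0 u)) ⟩
          + 1 - + 0                   ≡⟨ ℤ.+-identityʳ (+ 1) ⟩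
          + 1                         ∎)
          where
          open import Relation.Binary.Reasoning.Setoid ≈-setoid
          identity : ∀ r v → r * - v ≡ + 1 - (+ 1 + v * r)
          identity = solve-∀

    -- Abstract, so that the Bézout computation never unfolds inside types.
    abstract
      inverse : ∀ x → x ≉ + 0 → ∃ λ y → x * y ≈ + 1
      inverse = bézout-inverse

    inverse-unique : ∀ {x y z} → x * y ≈ + 1 → x * z ≈ + 1 → y ≈ z
    inverse-unique {x} {y} {z} xy≈1 xz≈1 = begin
      y            ≡⟨ ℤ.*-identityʳ y ⟨
      y * + 1      ≈⟨ *-cong (≈-refl {y}) xz≈1 ⟨
      y * (x * z)  ≡⟨ identity x y z ⟩
      (x * y) * z  ≈⟨ *-cong xy≈1 (≈-refl {z}) ⟩
      + 1 * z      ≡⟨ ℤ.*-identityˡ z ⟩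
      z            ∎
      where
      open import Relation.Binary.Reasoning.Setoid ≈-setoid
      identity : ∀ x y z → y * (x * z) ≡ (x * y) * z
      identity = solve-∀

    *-cancelˡ-≈ : ∀ {a x y} → a ≉ + 0 → a * x ≈ a * y → x ≈ y
    *-cancelˡ-≈ {a} {x} {y} a≉0 ax≈ay with ≈0-* a (x - y) (begin
      a * (x - y)     ≡⟨ identity a x y ⟩
      a * x - a * y   ≈⟨ ≈⇒-≈0 ax≈ay ⟩
      + 0             ∎)
      where
      open import Relation.Binary.Reasoning.Setoid ≈-setoid
      identity : ∀ a x y → a * (x - y) ≡ a * x - a * y
      identity = solve-∀
    ... | inj₁ a≈0 = ⊥-elim (a≉0 a≈0)
    ... | inj₂ x-y≈0 = -≈0⇒≈ x-y≈0

    square-≈⇒± : ∀ {x y} → x * x ≈ y * y → x ≈ y ⊎ x ≈ - y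
    square-≈⇒± {x} {y} xx≈yy with ≈0-* (x - y) (x + y) (begin
      (x - y) * (x + y) ≡⟨ identity x y ⟩
      x * x - y * y     ≈⟨ ≈⇒-≈0 xx≈yy ⟩
      + 0               ∎)
      where
      open import Relation.Binary.Reasoning.Setoid ≈-setoid
      identity : ∀ x y → (x - y) * (x + y) ≡ x * x - y * y
      identity = solve-∀
    ... | inj₁ x-y≈0 = inj₁ (-≈0⇒≈ x-y≈0)
    ... | inj₂ x+y≈0 = inj₂ (-≈0⇒≈ (≈-trans (≈-reflexive (cong (λ t → x + t) (ℤ.neg-involutive y))) x+y≈0))

module QuadraticResidues where

  open import Data.Bool as Bool using (Bool; true; false; not; T; if_then_else_)
  open import Data.Bool.Properties using (T?; T-≡)
  open import Data.Nat as ℕ using (ℕ; zero; suc; z<s; s<s; z≤n; s≤s; _≡ᵇ_; _<ᵇ_)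
  import Data.Nat.Properties as ℕ
  open import Data.Nat.DivMod using (m<n⇒m%n≡m)
  open import Data.Nat.Primality using (Prime; prime⇒nonTrivial; ¬prime[1])
  open import Data.Integer as ℤ using (ℤ; +_; _+_; _*_; -_; _-_)
  import Data.Integer.Properties as ℤ
  open import Data.Integer.Tactic.RingSolver using (solve-∀)
  open import Data.List.Relation.Unary.Any.Properties using (any⇔; applyUpTo⁺; applyUpTo⁻)
  open import Data.Product using (∃; _×_; _,_; proj₁; proj₂)
  open import Data.Sum as Sum using (_⊎_; inj₁; inj₂; [_,_]′)
  open import Data.Empty using (⊥-elim)
  open import Function using (_∘_)
  open import Function.Bundles using (_⇔_; mk⇔; module Equivalence)
  open import Relation.Binary.PropositionalEquality
  open import Relation.Nullary using (¬_; yes; no)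
  open import Function.Construct.Composition using (_⇔-∘_)
  open import Function.Construct.Symmetry using (⇔-sym)
  open import Relation.Nullary.Decidable using (does-⇔; ⌊_⌋)
  open import Defs using (res; isSquareMod; ℤsq; legendre)
  open import Data.List using (upTo)
  open Brackets
  open FiniteSums
  open Congruences

  module OddPrime (h : ℕ) (prime : Prime (suc (2 ℕ.* h))) where

    p : ℕ
    p = suc (2 ℕ.* h)

    open Congruence p public
    open Residue p public
    open PrimeModulus p prime public
    open import Relation.Binary.Reasoning.Setoid ≈-setoid

    Square : ℤ → Set
    Square x = ∃ λ y → y * y ≈ x

    Square-cong : ∀ {x y} → x ≈ y → Square x → Square y
    Square-cong x≈y (z , zz≈x) = z , ≈-trans zz≈x x≈y

    Square-* : ∀ {x y} → Square x → Square y → Square (x * y)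
    Square-* {x} {y} (u , uu≈x) (v , vv≈y) = u * v , (begin
      (u * v) * (u * v) ≡⟨ identity u v ⟩
      (u * u) * (v * v) ≈⟨ *-cong uu≈x vv≈y ⟩
      x * y             ∎)
      where
      identity : ∀ u v → (u * v) * (u * v) ≡ (u * u) * (v * v)
      identity = solve-∀

    Square-inverse : ∀ {x y} → x * y ≈ + 1 → Square x → Square y
    Square-inverse {x} {y} xy≈1 sx = Square-cong (begin
      x * (y * y)   ≡⟨ ℤ.*-assoc x y y ⟨
      (x * y) * y   ≈⟨ *-cong xy≈1 (≈-refl {y}) ⟩
      + 1 * y       ≡⟨ ℤ.*-identityˡ y ⟩
      y             ∎) (Square-* sx (y , ≈-refl))

    Square-*-square⇔ : ∀ a k → k ≉ + 0 → Square (a * (k * k)) ⇔ Square a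
    Square-*-square⇔ a k k≉0 = mk⇔ from-product (λ sa → Square-* sa (k , ≈-refl))
      where
      k⁻¹ = proj₁ (inverse k k≉0)
      kk⁻¹≈1 = proj₂ (inverse k k≉0)
      from-product : Square (a * (k * k)) → Square a
      from-product s = Square-cong (begin
        a * (k * k) * (k⁻¹ * k⁻¹)   ≡⟨ identity a k k⁻¹ ⟩
        a * ((k * k⁻¹) * (k * k⁻¹)) ≈⟨ *-cong (≈-refl {a}) (*-cong kk⁻¹≈1 kk⁻¹≈1) ⟩
        a * (+ 1 * + 1)             ≡⟨ ℤ.*-identityʳ a ⟩
        a                           ∎) (Square-* s (k⁻¹ , ≈-refl))
        where
        identity : ∀ a k l → a * (k * k) * (l * l) ≡ a * ((k * l) * (k * l))
        identity = solve-∀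

    -- χ is abstract: unfolding isSquareMod (and _%_) during unification is prohibitively expensive.
    abstract
      χ : ℤ → Bool
      χ x = isSquareMod (res x p) p

      χ⇔Square : ∀ x → T (χ x) ⇔ Square x
      χ⇔Square x = mk⇔ to from
        where
        squares-to-r : ℕ → Bool
        squares-to-r i = (i ℕ.* i) ℕ.% p ≡ᵇ res x p ℕ.% p
        res-x% : res x p ℕ.% p ≡ res x p
        res-x% = m<n⇒m%n≡m (res<p x)
        to : T (χ x) → Square x
        to t with applyUpTo⁻ (λ i → i) {n = p} (Equivalence.from (any⇔ {xs = upTo p} {p = squares-to-r}) t)
        ... | i , _ , hit = + i , (begin
          + i * + i   ≡⟨ ℤ.pos-* i i ⟨
          + (i ℕ.* i) ≈⟨ res-injective (trans (ℕ.≡ᵇ⇒≡ ((i ℕ.* i) ℕ.% p) (res x p ℕ.% p) hit) res-x%) ⟩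
          x           ∎)
        from : Square x → T (χ x)
        from (y , yy≈x) = Equivalence.to (any⇔ {xs = upTo p} {p = squares-to-r}) (applyUpTo⁺ (λ i → i) {i = res y p}
          (ℕ.≡⇒≡ᵇ ((r ℕ.* r) ℕ.% p) (res x p ℕ.% p) rr≡x) (res<p y))
          where
          r : ℕ
          r = res y p
          rr≡x : (r ℕ.* r) ℕ.% p ≡ res x p ℕ.% p
          rr≡x = trans (res-cong (≈-trans (≈-reflexive (ℤ.pos-* r r)) (≈-trans (*-cong (res-≈ y) (res-≈ y)) yy≈x)))
                       (sym res-x%)

      χ-cong : ∀ {x y} → x ≈ y → χ x ≡ χ y
      χ-cong x≈y = cong (λ r → isSquareMod r p) (res-cong x≈y)

      χ-def : ∀ x → χ x ≡ isSquareMod (res x p) p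
      χ-def x = refl

    χ-⇔ : ∀ {x y} → Square x ⇔ Square y → χ x ≡ χ y
    χ-⇔ {x} {y} sx⇔sy = does-⇔ (⇔-sym (χ⇔Square y) ⇔-∘ (sx⇔sy ⇔-∘ χ⇔Square x)) (T? (χ x)) (T? (χ y))

    n : ℕ
    n = 2 ℕ.* h

    p∸suc-h≡h : p ℕ.∸ suc h ≡ h
    p∸suc-h≡h = trans (ℕ.m+n∸m≡n h (h ℕ.+ 0)) (ℕ.+-identityʳ h)

    h<p : h ℕ.< p
    h<p = s≤s (ℕ.m≤m+n h (h ℕ.+ 0))

    root-≤h : ∀ w → w ≉ + 0 → ∃ λ k → 0 ℕ.< k × k ℕ.≤ h × + k * + k ≈ w * w
    root-≤h w w≉0 with ℕ.≤-<-connex (res w p) h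
    ... | inj₁ v≤h = v , ℕ.n≢0⇒n>0 (res≢0 w≉0) , v≤h , *-cong (res-≈ w) (res-≈ w)
      where v = res w p
    ... | inj₂ h<v = p ℕ.∸ v , ℕ.m<n⇒0<n∸m (res<p w) , p∸v≤h , (begin
      + (p ℕ.∸ v) * + (p ℕ.∸ v) ≈⟨ *-cong p∸v≈-v p∸v≈-v ⟩
      - + v * - + v             ≡⟨ identity (+ v) ⟩
      + v * + v                 ≈⟨ *-cong (res-≈ w) (res-≈ w) ⟩
      w * w                     ∎)
      where
      v = res w p
      p∸v≤h : p ℕ.∸ v ℕ.≤ h
      p∸v≤h = subst (p ℕ.∸ v ℕ.≤_) p∸suc-h≡h (ℕ.∸-monoʳ-≤ p h<v)
      p∸v≈-v : + (p ℕ.∸ v) ≈ - + v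
      p∸v≈-v = p∸n≈-n v (ℕ.<⇒≤ (res<p w))
      identity : ∀ v → - v * - v ≡ v * v
      identity = solve-∀

    module ScaledSquares (a : ℤ) (a≉0 : a ≉ + 0) where

      -- Abstract for the same reason as χ.
      abstract
        R : ℕ → ℕ
        R i = res (a * ℤsq (suc i)) p

        R-≈ : ∀ i → + R i ≈ a * (+ suc i * + suc i)
        R-≈ i = ≈-trans (res-≈ (a * ℤsq (suc i))) (≈-reflexive (cong (a *_) (ℤ.pos-* (suc i) (suc i))))

        R<p : MapsTo h p R
        R<p i _ = res<p (a * ℤsq (suc i))

        R-def : ∀ i → R i ≡ res (a * ℤsq (suc i)) p
        R-def i = refl

      suc≉0 : ∀ {i} → i ℕ.< h → + suc i ≉ + 0
      suc≉0 i<h = <p⇒≉0 z<s (ℕ.≤-<-trans i<h h<p)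

      R-injective : InjectiveOn h R
      R-injective i j i<h j<h Ri≡Rj = [ same , opposite ]′ (square-≈⇒± (*-cancelˡ-≈ a≉0 (begin
        a * (+ suc i * + suc i) ≈⟨ R-≈ i ⟨
        + R i                   ≡⟨ cong +_ Ri≡Rj ⟩
        + R j                   ≈⟨ R-≈ j ⟩
        a * (+ suc j * + suc j) ∎)))
        where
        same : + suc i ≈ + suc j → i ≡ j
        same i≈j = ℕ.suc-injective (<-≈⇒≡ (ℕ.≤-<-trans i<h h<p) (ℕ.≤-<-trans j<h h<p) i≈j)
        i+j<p : suc i ℕ.+ suc j ℕ.< p
        i+j<p = s≤s (ℕ.+-mono-≤ i<h (ℕ.≤-trans j<h (ℕ.≤-reflexive (sym (ℕ.+-identityʳ h)))))
        opposite : + suc i ≈ - + suc j → i ≡ j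
        opposite i≈-j = ⊥-elim (<p⇒≉0 z<s i+j<p (begin
          + (suc i ℕ.+ suc j)  ≡⟨ ℤ.pos-+ (suc i) (suc j) ⟩
          + suc i + + suc j    ≈⟨ +-cong i≈-j (≈-refl {+ suc j}) ⟩
          - + suc j + + suc j  ≡⟨ ℤ.+-inverseˡ (+ suc j) ⟩
          + 0                  ∎))

      c : ℕ → ℕ
      c = mult h R

      c≤1 : ∀ x → c x ℕ.≤ 1
      c≤1 x = mult-≤1 h R x R-injective

      c[0]≡0 : c 0 ≡ 0
      c[0]≡0 = mult-zero h R 0 (λ i i<h → res≢0 (≉0-* a≉0 (sq≉0 i<h)) ∘ trans (sym (R-def i)))
        where
        sq≉0 : ∀ {i} → i ℕ.< h → ℤsq (suc i) ≉ + 0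
        sq≉0 {i} i<h = subst (_≉ + 0) (sym (ℤ.pos-* (suc i) (suc i))) (≉0-* (suc≉0 i<h) (suc≉0 i<h))

      ∑c : ∑[ u < n ] c (suc u) ≡ h
      ∑c = trans (cong (ℕ._+ ∑[ u < n ] c (suc u)) (sym c[0]≡0)) (∑-mult h p R R<p)

      R≡x⇒χ≡ : ∀ i x → i ℕ.< h → R i ≡ x → χ (+ x) ≡ χ a
      R≡x⇒χ≡ i x i<h Ri≡x = trans (χ-cong (≈-trans (≈-reflexive (cong +_ (sym Ri≡x))) (R-≈ i)))
                                   (χ-⇔ (Square-*-square⇔ a (+ suc i) (suc≉0 i<h)))

      c≤same : ∀ x → c x ℕ.≤ ⟦ ⌊ χ (+ x) Bool.≟ χ a ⌋ ⟧
      c≤same x with χ (+ x) Bool.≟ χ a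
      ... | yes _ = c≤1 x
      ... | no χx≢χa = ℕ.≤-reflexive (mult-zero h R x (λ i i<h Ri≡x → χx≢χa (R≡x⇒χ≡ i x i<h Ri≡x)))

    1<p : 1 ℕ.< p
    1<p = ℕ.nonTrivial⇒n>1 p {{prime⇒nonTrivial prime}}

    1≉0 : + 1 ≉ + 0
    1≉0 = <p⇒≉0 z<s 1<p

    χ[1] : χ (+ 1) ≡ true
    χ[1] = Equivalence.to T-≡ (Equivalence.from (χ⇔Square (+ 1)) (+ 1 , ≈-refl))

    module Squares = ScaledSquares (+ 1) 1≉0

    squares-hit : ∀ x → 0 ℕ.< x → x ℕ.< p → T (χ (+ x)) → Squares.c x ≡ 1
    squares-hit x 0<x x<p χx with Equivalence.to (χ⇔Square (+ x)) χx
    ... | z , zz≈x with root-≤h z z≉0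
      where
      z≉0 : z ≉ + 0
      z≉0 z≈0 = <p⇒≉0 0<x x<p (≈-trans (≈-sym zz≈x) (≈-trans (*-cong z≈0 (≈-refl {z})) (≈-reflexive refl)))
    ... | suc i , _ , i<h , kk≈zz = subst (λ y → Squares.c y ≡ 1) Ri≡x
                                     (mult-image h Squares.R i Squares.R-injective i<h)
      where
      Ri≡x : Squares.R i ≡ x
      Ri≡x = <-≈⇒≡ (Squares.R<p i i<h) x<p (begin
        + Squares.R i              ≈⟨ Squares.R-≈ i ⟩
        + 1 * (+ suc i * + suc i)  ≡⟨ ℤ.*-identityˡ _ ⟩
        + suc i * + suc i          ≈⟨ kk≈zz ⟩
        z * z                      ≈⟨ zz≈x ⟩
        + x                        ∎)

    ∑χ : ∑[ u < n ] ⟦ χ (+ suc u) ⟧ ≡ h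
    ∑χ = trans (∑-cong n (λ u u<n → sym (c≡χ u u<n))) Squares.∑c
      where
      c≡χ : ∀ u → u ℕ.< n → Squares.c (suc u) ≡ ⟦ χ (+ suc u) ⟧
      c≡χ u u<n with χ (+ suc u) in χu
      ... | true = squares-hit (suc u) z<s (s<s u<n) (subst T (sym χu) _)
      ... | false = ℕ.n≤0⇒n≡0 (subst (λ b → Squares.c (suc u) ℕ.≤ ⟦ ⌊ b Bool.≟ true ⌋ ⟧) χu
                                      (subst (λ b → Squares.c (suc u) ℕ.≤ ⟦ ⌊ χ (+ suc u) Bool.≟ b ⌋ ⟧) χ[1]
                                             (Squares.c≤same (suc u))))

    ∑χ≟ : ∀ b → ∑[ u < n ] ⟦ ⌊ χ (+ suc u) Bool.≟ b ⌋ ⟧ ≡ h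
    ∑χ≟ true = trans (∑-cong n (λ u _ → ⟦≟true⟧ (χ (+ suc u)))) ∑χ
      where
      ⟦≟true⟧ : ∀ b → ⟦ ⌊ b Bool.≟ true ⌋ ⟧ ≡ ⟦ b ⟧
      ⟦≟true⟧ true = refl
      ⟦≟true⟧ false = refl
    ∑χ≟ false = trans (∑-cong n (λ u _ → ⟦≟false⟧ (χ (+ suc u)))) ∑not-χ
      where
      ⟦≟false⟧ : ∀ b → ⟦ ⌊ b Bool.≟ false ⌋ ⟧ ≡ ⟦ not b ⟧
      ⟦≟false⟧ true = refl
      ⟦≟false⟧ false = refl
      ∑not-χ : ∑[ u < n ] ⟦ not (χ (+ suc u)) ⟧ ≡ h
      ∑not-χ = ℕ.+-cancelˡ-≡ h _ _ (trans (cong (ℕ._+ ∑[ u < n ] ⟦ not (χ (+ suc u)) ⟧) (sym ∑χ))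
                                    (trans (∑⟦⟧+∑⟦not⟧ n (λ u → χ (+ suc u))) (cong (h ℕ.+_) (ℕ.+-identityʳ h))))

    -- c ≤ [χ x = χ a] pointwise, and both sides sum to h.
    mult-χ : ∀ a (a≉0 : a ≉ + 0) u → u ℕ.< n → ScaledSquares.c a a≉0 (suc u) ≡ ⟦ ⌊ χ (+ suc u) Bool.≟ χ a ⌋ ⟧
    mult-χ a a≉0 = ∑-mono-≤-≡⇒≡ n (λ u _ → c≤same (suc u)) (trans ∑c (sym (∑χ≟ (χ a))))
      where open ScaledSquares a a≉0

    inverse-index : ∀ u → u ℕ.< n → ∃ λ w → w ℕ.< n × + suc u * + suc w ≈ + 1
    inverse-index u u<n with inverse (+ suc u) (<p⇒≉0 z<s (s<s u<n))
    ... | y , uy≈1 with res y p in ry | res<p y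
    ... | zero | _ = ⊥-elim (1≉0 (begin
      + 1           ≈⟨ uy≈1 ⟨
      + suc u * y   ≈⟨ *-cong (≈-refl {+ suc u}) (≈-trans (≈-sym (res-≈ y)) (≈-reflexive (cong +_ ry))) ⟩
      + suc u * + 0 ≡⟨ ℤ.*-zeroʳ (+ suc u) ⟩
      + 0           ∎))
    ... | suc w | s<s w<n = w , w<n , (begin
      + suc u * + suc w ≈⟨ *-cong (≈-refl {+ suc u}) (≈-trans (≈-reflexive (cong +_ (sym ry))) (res-≈ y)) ⟩
      + suc u * y       ≈⟨ uy≈1 ⟩
      + 1               ∎)

    inverts : ℕ → ℕ → Bool
    inverts u w = (suc u ℕ.* suc w) ℕ.% p ≡ᵇ 1

    recip : ℕ → ℕ
    recip u = search (inverts u) n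

    recip-spec : ∀ u → u ℕ.< n → recip u ℕ.< n × + suc u * + suc (recip u) ≈ + 1
    recip-spec u u<n = proj₁ found , ≈-trans (≈-reflexive (sym (ℤ.pos-* (suc u) (suc (recip u)))))
      (res-injective (trans (ℕ.≡ᵇ⇒≡ ((suc u ℕ.* suc (recip u)) ℕ.% p) 1 (proj₂ found)) (sym (res-of-< 1<p))))
      where
      w = proj₁ (inverse-index u u<n)
      w<n = proj₁ (proj₂ (inverse-index u u<n))
      uw≈1 = proj₂ (proj₂ (inverse-index u u<n))
      found : recip u ℕ.< n × T (inverts u (recip u))
      found = search-found (inverts u) n w w<n (ℕ.≡⇒≡ᵇ ((suc u ℕ.* suc w) ℕ.% p) 1
        (trans (res-cong (≈-trans (≈-reflexive (ℤ.pos-* (suc u) (suc w))) uw≈1)) (res-of-< 1<p)))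

    recip<n : MapsTo n n recip
    recip<n u u<n = proj₁ (recip-spec u u<n)

    recip-fixed : ∀ u → u ℕ.< n → + suc u * + suc u ≈ + 1 → recip u ≡ u
    recip-fixed u u<n uu≈1 = ℕ.suc-injective (<-≈⇒≡ (s<s (recip<n u u<n)) (s<s u<n)
                                            (inverse-unique {+ suc u} (proj₂ (recip-spec u u<n)) uu≈1))

    recip-involution : Involution n recip
    recip-involution = recip<n , λ u u<n → ℕ.suc-injective (<-≈⇒≡ (s<s (recip<n (recip u) (recip<n u u<n))) (s<s u<n)
      (inverse-unique {+ suc (recip u)} (proj₂ (recip-spec (recip u) (recip<n u u<n)))
                      (≈-trans (≈-reflexive (ℤ.*-comm (+ suc (recip u)) (+ suc u))) (proj₂ (recip-spec u u<n)))))

    0<h : 0 ℕ.< h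
    0<h = ℕ.n≢0⇒n>0 (λ h≡0 → ¬prime[1] (subst (λ k → Prime (suc (2 ℕ.* k))) h≡0 prime))

    1<n : 1 ℕ.< n
    1<n = ℕ.*-monoʳ-≤ 2 0<h

    last : ℕ
    last = ℕ.pred n

    suc-last≡n : suc last ≡ n
    suc-last≡n = ℕ.suc-pred n {{ℕ.>-nonZero (ℕ.<-trans z<s 1<n)}}

    last<n : last ℕ.< n
    last<n = ℕ.≤-reflexive suc-last≡n

    last≢0 : last ≢ 0
    last≢0 last≡0 = ℕ.<-irrefl (trans (cong suc (sym last≡0)) suc-last≡n) 1<n

    n≈-1 : + n ≈ - + 1
    n≈-1 = p∸n≈-n 1 (s≤s z≤n)

    recip-fixed⇒ : ∀ u → u ℕ.< n → recip u ≡ u → u ≡ 0 ⊎ u ≡ last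
    recip-fixed⇒ u u<n ru≡u = Sum.map
      (λ u≈1 → ℕ.suc-injective (<-≈⇒≡ (s<s u<n) 1<p u≈1))
      (λ u≈-1 → cong ℕ.pred (<-≈⇒≡ (s<s u<n) ℕ.≤-refl (≈-trans u≈-1 (≈-sym n≈-1))))
      (square-≈⇒± {+ suc u} {+ 1} (subst (λ w → + suc u * + suc w ≈ + 1) ru≡u (proj₂ (recip-spec u u<n))))

    recip-0 : recip 0 ≡ 0
    recip-0 = recip-fixed 0 (ℕ.<-trans z<s 1<n) ≈-refl

    recip-last : recip last ≡ last
    recip-last = recip-fixed last last<n (begin
      + suc last * + suc last ≡⟨ cong (λ k → + k * + k) suc-last≡n ⟩
      + n * + n               ≈⟨ *-cong n≈-1 n≈-1 ⟩
      - + 1 * - + 1           ≡⟨⟩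
      + 1                     ∎)

    δ-recip : ∀ u → u ℕ.< n → δ (recip u) u ≡ δ 0 u ℕ.+ δ last u
    δ-recip u u<n = δ-⊎ (last≢0 ∘ sym) (mk⇔ (recip-fixed⇒ u u<n) [ fixed-at {0} recip-0 , fixed-at {last} recip-last ]′)
      where
      fixed-at : ∀ {v} → recip v ≡ v → u ≡ v → recip u ≡ u
      fixed-at rv≡v u≡v = subst (λ w → recip w ≡ w) (sym u≡v) rv≡v

    χ-recip : ∀ u → u ℕ.< n → χ (+ suc (recip u)) ≡ χ (+ suc u)
    χ-recip u u<n = χ-⇔ (mk⇔ (Square-inverse ru*u≈1) (Square-inverse u*ru≈1))
      where
      u*ru≈1 = proj₂ (recip-spec u u<n)
      ru*u≈1 = ≈-trans (≈-reflexive (ℤ.*-comm (+ suc (recip u)) (+ suc u))) u*ru≈1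

    -- The reciprocal map pairs up the squares in [1, p - 1] except its fixed points 1 and p - 1.
    -- There are h of them, so for even h the point p - 1 ≡ -1 must be a square.
    minus-one-square : ∀ m → h ≡ 2 ℕ.* m → Square (- + 1)
    minus-one-square m h≡2m =
      Square-cong n≈-1 (Equivalence.to (χ⇔Square (+ n)) (subst (T ∘ χ ∘ +_) suc-last≡n (⟦⟧≡1⇒T g[last]≡1)))
      where
      g : ℕ → ℕ
      g u = ⟦ χ (+ suc u) ⟧
      Below = ∑[ u < n ] (⟦ recip u <ᵇ u ⟧ ℕ.* g u)
      fixed-part : ∑[ u < n ] (δ (recip u) u ℕ.* g u) ≡ 1 ℕ.+ g last
      fixed-part = trans (∑-cong n (λ u u<n → cong (ℕ._* g u) (δ-recip u u<n)))
                         (trans (∑-δ₂ n g (ℕ.<-trans z<s 1<n) last<n) (cong (λ b → ⟦ b ⟧ ℕ.+ g last) χ[1]))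
      2m≡1+g[last]+2*Below : 2 ℕ.* m ≡ 1 ℕ.+ g last ℕ.+ 2 ℕ.* Below
      2m≡1+g[last]+2*Below = trans (sym h≡2m) (trans (sym ∑χ)
        (trans (∑-involution-parity n recip g recip-involution (λ u u<n → cong ⟦_⟧ (χ-recip u u<n)))
               (cong (ℕ._+ 2 ℕ.* Below) fixed-part)))
      g[last]≡1 : g last ≡ 1
      g[last]≡1 = 2*m≡1+b+2*k⇒b≡1 m (g last) Below (⟦⟧≤1 _) 2m≡1+g[last]+2*Below

    χ-neg : Square (- + 1) → ∀ x → χ (- x) ≡ χ x
    χ-neg s x = χ-⇔ (mk⇔ (Square-cong (≈-reflexive (identity₁ x)) ∘ Square-* s)
                         (Square-cong (≈-reflexive (identity₂ x)) ∘ Square-* s))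
      where
      identity₁ : ∀ x → - + 1 * - x ≡ x
      identity₁ = solve-∀
      identity₂ : ∀ x → - + 1 * x ≡ - x
      identity₂ = solve-∀

    χ-p∸ : Square (- + 1) → ∀ x → x ℕ.≤ p → χ (+ (p ℕ.∸ x)) ≡ χ (+ x)
    χ-p∸ s x x≤p = trans (χ-cong (p∸n≈-n x x≤p)) (χ-neg s (+ x))

    legendre≡ : ∀ x → x ≉ + 0 → legendre x p ≡ (if χ x then + 1 else - + 1)
    legendre≡ x x≉0 with res x p ≡ᵇ 0 in r≡ᵇ0
    ... | true = ⊥-elim (res≢0 x≉0 (ℕ.≡ᵇ⇒≡ (res x p) 0 (subst T (sym r≡ᵇ0) _)))
    ... | false = cong (λ b → if b then + 1 else - + 1) (sym (χ-def x))

    legendre-≟ : ∀ x y → x ≉ + 0 → y ≉ + 0 → ⌊ legendre x p ℤ.≟ legendre y p ⌋ ≡ ⌊ χ x Bool.≟ χ y ⌋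
    legendre-≟ x y x≉0 y≉0 rewrite legendre≡ x x≉0 | legendre≡ y y≉0 = sign-≟ (χ x) (χ y)
      where
      sign-≟ : ∀ b c → ⌊ (if b then + 1 else - + 1) ℤ.≟ (if c then + 1 else - + 1) ⌋ ≡ ⌊ b Bool.≟ c ⌋
      sign-≟ true true = refl
      sign-≟ true false = refl
      sign-≟ false true = refl
      sign-≟ false false = refl

module PairCount where

  open import Data.Bool as Bool using (Bool; _∧_)
  open import Data.Nat as ℕ using (ℕ; suc; z<s; s<s; _<ᵇ_; _+_; _*_; _∸_; ∣_-_∣)
  import Data.Nat.Properties as ℕ
  open import Data.Nat.DivMod using (m*n/n≡m; m≡m%n+[m/n]*n; [m+kn]%n≡m%n)
  open import Data.Nat.Primality using (Prime)
  open import Data.Integer as ℤ using (ℤ; +_)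
  open import Data.Integer.Divisibility using (_∣_)
  open import Data.Integer.Divisibility.Signed using (∣⇒∣ᵤ)
  open import Data.Product using (_,_)
  open import Function using (_∘_)
  open import Function.Bundles using (module Equivalence)
  open import Relation.Binary.PropositionalEquality
  open import Relation.Nullary using (¬_)
  open import Relation.Nullary.Decidable using (⌊_⌋)
  open import Data.Nat.Tactic.RingSolver using (solve-∀)
  open import Defs
  open Brackets
  open FiniteSums
  open Congruences
  open QuadraticResidues

  module _ (m : ℕ) (prime : Prime (suc (2 * (2 * m)))) (a : ℤ) where

    h : ℕ
    h = 2 * m

    open OddPrime h prime

    module _ (a≉0 : a ≉ + 0) where

      open ScaledSquares a a≉0

      c-reflect : ∀ u → u ℕ.< n → c (suc (n ∸ suc u)) ≡ c (suc u)
      c-reflect u u<n = begin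
        c (suc (n ∸ suc u))                       ≡⟨ mult-χ a a≉0 (n ∸ suc u) (ℕ.∸-monoʳ-< z<s u<n) ⟩
        ⟦ ⌊ χ (+ suc (n ∸ suc u)) Bool.≟ χ a ⌋ ⟧   ≡⟨ cong (λ b → ⟦ ⌊ b Bool.≟ χ a ⌋ ⟧) χ-reflect ⟩
        ⟦ ⌊ χ (+ suc u) Bool.≟ χ a ⌋ ⟧             ≡⟨ mult-χ a a≉0 u u<n ⟨
        c (suc u)                                 ∎
        where
        open ≡-Reasoning
        χ-reflect : χ (+ suc (n ∸ suc u)) ≡ χ (+ suc u)
        χ-reflect = trans (cong (χ ∘ +_) (sym (ℕ.+-∸-assoc 1 u<n))) (χ-p∸ (minus-one-square m refl) (suc u) (ℕ.<⇒≤ (s<s u<n)))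

      far : ℕ → ℕ → Bool
      far x y = p <ᵇ 2 * ∣ x - y ∣

      p-odd : ∀ e → e + e ≢ p
      p-odd e e+e≡p = ℕ.even≢odd e h (trans (cong (λ t → e + t) (ℕ.+-identityʳ e)) e+e≡p)

      inversion+wrap-res : ∀ x y → x ℕ.< p → y ℕ.< p →
        ⟦ y <ᵇ x ⟧ + ⟦ p <ᵇ 2 * res (+ y ℤ.- + x) p ⟧ ≡ ⟦ far x y ⟧ + 2 * ⟦ (y <ᵇ x) ∧ (2 * (x ∸ y) <ᵇ p) ⟧
      inversion+wrap-res x y x<p y<p = inversion+wrap p x y (res (+ y ℤ.- + x) p) p-odd (ℕ.<⇒≤ x<p)
        (λ x≤y → res-difference-≤ x≤y y<p) (λ y<x → res-difference-> y<x x<p)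

      half : (p ∸ 1) ℕ./ 2 ≡ h
      half = trans (cong (ℕ._/ 2) (ℕ.*-comm 2 h)) (m*n/n≡m h 2)

      count-pairs : ∀ P → count P (pairsLt ((p ∸ 1) ℕ./ 2)) ≡ ∑[ i < h ] ∑[ k < h ] (⟦ i <ᵇ k ⟧ * ⟦ P (suc i , suc k) ⟧)
      count-pairs P = trans (cong (λ t → count P (pairsLt t)) half) (count-pairsLt P h)

      count1≡ : count1 a p ≡ ∑[ i < h ] ∑[ k < h ] (⟦ i <ᵇ k ⟧ * ⟦ R k <ᵇ R i ⟧)
      count1≡ = trans (count-pairs _)
        (∑-cong h (λ i _ → ∑-cong h (λ k _ → cong₂ (λ r s → ⟦ i <ᵇ k ⟧ * ⟦ r <ᵇ s ⟧) (sym (R-def k)) (sym (R-def i)))))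

      count2≡ : count2 a p ≡ ∑[ i < h ] ∑[ k < h ] (⟦ i <ᵇ k ⟧ * ⟦ p <ᵇ 2 * res (+ R k ℤ.- + R i) p ⟧)
      count2≡ = trans (count-pairs _)
        (∑-cong h (λ i _ → ∑-cong h (λ k _ → cong (λ r → ⟦ i <ᵇ k ⟧ * ⟦ p <ᵇ 2 * r ⟧)
          (res-cong (+-cong (≈-sym (+R≈ k)) (-‿cong (≈-sym (+R≈ i))))))))
        where
        +R≈ : ∀ i → + R i ≈ a ℤ.* ℤsq (suc i)
        +R≈ i = ≈-trans (≈-reflexive (cong +_ (R-def i))) (res-≈ (a ℤ.* ℤsq (suc i)))

      Far Wrapped : ℕ
      Far = ∑[ i < h ] ∑[ k < h ] (⟦ i <ᵇ k ⟧ * ⟦ far (R i) (R k) ⟧)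
      Wrapped = ∑[ i < h ] ∑[ k < h ] (⟦ i <ᵇ k ⟧ * ⟦ (R k <ᵇ R i) ∧ (2 * (R i ∸ R k) <ᵇ p) ⟧)

      count1+count2≡ : count1 a p + count2 a p ≡ Far + 2 * Wrapped
      count1+count2≡ = begin
        count1 a p + count2 a p
          ≡⟨ trans (cong₂ _+_ count1≡ count2≡) (sym (∑∑-+ h h _ _)) ⟩
        ∑[ i < h ] ∑[ k < h ] (⟦ i <ᵇ k ⟧ * ⟦ R k <ᵇ R i ⟧ + ⟦ i <ᵇ k ⟧ * ⟦ p <ᵇ 2 * res (+ R k ℤ.- + R i) p ⟧)
          ≡⟨ ∑-cong h (λ i i<h → ∑-cong h (λ k k<h → scale ⟦ i <ᵇ k ⟧ (inversion+wrap-res (R i) (R k) (R<p i i<h) (R<p k k<h)))) ⟩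
        ∑[ i < h ] ∑[ k < h ] (⟦ i <ᵇ k ⟧ * ⟦ far (R i) (R k) ⟧ + 2 * (⟦ i <ᵇ k ⟧ * ⟦ (R k <ᵇ R i) ∧ (2 * (R i ∸ R k) <ᵇ p) ⟧))
          ≡⟨ trans (∑∑-+ h h _ _) (cong (λ t → Far + t) (∑∑-*ˡ h h 2 _)) ⟩
        Far + 2 * Wrapped
          ∎
        where
        open ≡-Reasoning
        scale : ∀ t {A B C D} → A + B ≡ C + 2 * D → t * A + t * B ≡ t * C + 2 * (t * D)
        scale t {A} {B} {C} {D} e = trans (sym (ℕ.*-distribˡ-+ t A B)) (trans (cong (t *_) e) (rearrange t C D))
          where
          rearrange : ∀ t C D → t * (C + 2 * D) ≡ t * C + 2 * (t * D)
          rearrange = solve-∀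

      Φ : ℕ → ℕ → ℕ
      Φ x y = ⟦ x <ᵇ y ⟧ * ⟦ far x y ⟧

      F : ℕ → ℕ → ℕ
      F u v = c (suc u) * c (suc v) * Φ (suc u) (suc v)

      Below : ℕ
      Below = ∑[ u < n ] ∑[ v < n ] (⟦ suc (u + v) <ᵇ n ⟧ * F u v)

      Far≡∑∑F : Far ≡ ∑[ u < n ] ∑[ v < n ] F u v
      Far≡∑∑F = begin
        Far
          ≡⟨ ∑∑-<-injective h R (λ i k → ⟦ far (R i) (R k) ⟧) R-injective far-sym ⟨
        ∑[ i < h ] ∑[ k < h ] Φ (R i) (R k)                         ≡⟨ ∑∑-fibres h p R Φ R<p ⟩
        ∑[ x < p ] ∑[ y < p ] (c x * c y * Φ x y)                   ≡⟨ ∑∑-drop-zero n c Φ c[0]≡0 ⟩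
        ∑[ u < n ] ∑[ v < n ] F u v                                ∎
        where
        open ≡-Reasoning
        far-sym : ∀ i k → ⟦ far (R i) (R k) ⟧ ≡ ⟦ far (R k) (R i) ⟧
        far-sym i k = cong (λ d → ⟦ p <ᵇ 2 * d ⟧) (ℕ.∣-∣-comm (R i) (R k))

      suc[n∸suc]+suc≡p : ∀ u → u ℕ.< n → suc (n ∸ suc u) + suc u ≡ p
      suc[n∸suc]+suc≡p u u<n = cong suc (ℕ.m∸n+n≡m u<n)

      F-reflect : ∀ u v → u ℕ.< n → v ℕ.< n → F (n ∸ suc v) (n ∸ suc u) ≡ F u v
      F-reflect u v u<n v<n = begin
        c x′ * c y′ * (⟦ x′ <ᵇ y′ ⟧ * ⟦ far x′ y′ ⟧)
          ≡⟨ cong₂ (λ s t → s * t * Φ x′ y′) (c-reflect v v<n) (c-reflect u u<n) ⟩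
        c (suc v) * c (suc u) * (⟦ x′ <ᵇ y′ ⟧ * ⟦ far x′ y′ ⟧)
          ≡⟨ cong₂ (λ s b → s * (⟦ b ⟧ * ⟦ p <ᵇ 2 * ∣ x′ - y′ ∣ ⟧)) (ℕ.*-comm (c (suc v)) (c (suc u)))
                   (<ᵇ-cong-⇔ (+-≡-<-⇔ x′ y′ (suc v) (suc u) x′+v≡y′+u)) ⟩
        c (suc u) * c (suc v) * (⟦ suc u <ᵇ suc v ⟧ * ⟦ far x′ y′ ⟧)
          ≡⟨ cong (λ d → c (suc u) * c (suc v) * (⟦ suc u <ᵇ suc v ⟧ * ⟦ p <ᵇ 2 * d ⟧))
                  (∣-∣-+-flip x′ y′ (suc v) (suc u) x′+v≡y′+u) ⟩
        F u v
          ∎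
        where
        open ≡-Reasoning
        x′ = suc (n ∸ suc v)
        y′ = suc (n ∸ suc u)
        x′+v≡y′+u : x′ + suc v ≡ y′ + suc u
        x′+v≡y′+u = trans (suc[n∸suc]+suc≡p v v<n) (sym (suc[n∸suc]+suc≡p u u<n))

      F-antidiagonal : ∀ u → u ℕ.< n → F u (n ∸ suc u) ≡ c (suc u) * ⟦ 4 * suc u <ᵇ p ⟧
      F-antidiagonal u u<n = begin
        c (suc u) * c (suc (n ∸ suc u)) * Φ (suc u) (suc (n ∸ suc u))
          ≡⟨ cong₂ (λ s t → c (suc u) * s * t) (c-reflect u u<n)
                   (⟦<ᵇ⟧*⟦>ᵇ⟧-antidiagonal p (suc u) (suc (n ∸ suc u)) (trans (ℕ.+-comm (suc u) _) (suc[n∸suc]+suc≡p u u<n))) ⟩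
        c (suc u) * c (suc u) * ⟦ 4 * suc u <ᵇ p ⟧
          ≡⟨ cong (_* ⟦ 4 * suc u <ᵇ p ⟧) (n≤1⇒n*n≡n (c≤1 (suc u))) ⟩
        c (suc u) * ⟦ 4 * suc u <ᵇ p ⟧
          ∎
        where open ≡-Reasoning

      Far≡ : Far ≡ ∑[ u < n ] (c (suc u) * ⟦ 4 * suc u <ᵇ p ⟧) + 2 * Below
      Far≡ = trans Far≡∑∑F (trans (∑∑-reflection n F F-reflect) (cong (_+ 2 * Below) (∑-cong n F-antidiagonal)))

      count3≡ : count3 a p ≡ ∑[ u < n ] (c (suc u) * ⟦ 4 * suc u <ᵇ p ⟧)
      count3≡ = begin
        count3 a p                                         ≡⟨ count-range1 P p ⟩
        ∑[ i < p ] ⟦ P (suc i) ⟧                            ≡⟨ ∑-suc n (λ i → ⟦ P (suc i) ⟧) ⟩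
        ∑[ u < n ] ⟦ P (suc u) ⟧ + ⟦ P p ⟧                  ≡⟨ cong₂ _+_ (∑-cong n term) P[p]≡0 ⟩
        ∑[ u < n ] (c (suc u) * ⟦ 4 * suc u <ᵇ p ⟧) + 0     ≡⟨ ℕ.+-identityʳ _ ⟩
        ∑[ u < n ] (c (suc u) * ⟦ 4 * suc u <ᵇ p ⟧)         ∎
        where
        open ≡-Reasoning
        P : ℕ → Bool
        P k = (4 * k <ᵇ p) ∧ ⌊ legendre (+ k) p ℤ.≟ legendre a p ⌋
        P[p]≡0 : ⟦ P p ⟧ ≡ 0
        P[p]≡0 = cong (λ b → ⟦ b ∧ ⌊ legendre (+ p) p ℤ.≟ legendre a p ⌋ ⟧) (<ᵇ-false (ℕ.m≤n*m p 4))
        term : ∀ u → u ℕ.< n → ⟦ P (suc u) ⟧ ≡ c (suc u) * ⟦ 4 * suc u <ᵇ p ⟧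
        term u u<n = begin
          ⟦ P (suc u) ⟧                                             ≡⟨ ⟦∧⟧ (4 * suc u <ᵇ p) _ ⟩
          ⟦ 4 * suc u <ᵇ p ⟧ * ⟦ ⌊ legendre (+ suc u) p ℤ.≟ legendre a p ⌋ ⟧
            ≡⟨ cong (λ b → ⟦ 4 * suc u <ᵇ p ⟧ * ⟦ b ⟧) (legendre-≟ (+ suc u) a (<p⇒≉0 z<s (s<s u<n)) a≉0) ⟩
          ⟦ 4 * suc u <ᵇ p ⟧ * ⟦ ⌊ χ (+ suc u) Bool.≟ χ a ⌋ ⟧       ≡⟨ cong (⟦ 4 * suc u <ᵇ p ⟧ *_) (mult-χ a a≉0 u u<n) ⟨
          ⟦ 4 * suc u <ᵇ p ⟧ * c (suc u)                            ≡⟨ ℕ.*-comm _ (c (suc u)) ⟩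
          c (suc u) * ⟦ 4 * suc u <ᵇ p ⟧                            ∎

      count1+count2≡count3+[Below+Wrapped]*2 : count1 a p + count2 a p ≡ count3 a p + (Below + Wrapped) * 2
      count1+count2≡count3+[Below+Wrapped]*2 = begin
        count1 a p + count2 a p                        ≡⟨ count1+count2≡ ⟩
        Far + 2 * Wrapped                              ≡⟨ cong (_+ 2 * Wrapped) Far≡ ⟩
        Anti + 2 * Below + 2 * Wrapped                 ≡⟨ cong (λ t → t + 2 * Below + 2 * Wrapped) count3≡ ⟨
        count3 a p + 2 * Below + 2 * Wrapped           ≡⟨ rearrange (count3 a p) Below Wrapped ⟩
        count3 a p + (Below + Wrapped) * 2             ∎
        where
        open ≡-Reasoning
        Anti = ∑[ u < n ] (c (suc u) * ⟦ 4 * suc u <ᵇ p ⟧)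
        rearrange : ∀ t b w → t + 2 * b + 2 * w ≡ t + (b + w) * 2
        rearrange = solve-∀

    count-parity : ¬ ((+ p) ∣ a) → (count1 a p + count2 a p) ℕ.% 2 ≡ count3 a p ℕ.% 2
    count-parity p∤a = trans (cong (ℕ._% 2) (count1+count2≡count3+[Below+Wrapped]*2 a≉0))
                             ([m+kn]%n≡m%n (count3 a p) (Below a≉0 + Wrapped a≉0) 2)
      where
      a≉0 : a ≉ + 0
      a≉0 a≈0 = p∤a (∣⇒∣ᵤ (Equivalence.to ≈0⇔∣ a≈0))

  p%4≡1⇒p≡4m+1 : ∀ p → p ℕ.% 4 ≡ 1 → p ≡ suc (2 * (2 * (p ℕ./ 4)))
  p%4≡1⇒p≡4m+1 p p%4≡1 = trans (m≡m%n+[m/n]*n p 4) (cong₂ _+_ p%4≡1 (rearrange (p ℕ./ 4)))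
    where
    rearrange : ∀ q → q * 4 ≡ 2 * (2 * q)
    rearrange = solve-∀

open import Defs
open import Data.Nat using (ℕ; _+_; _%_; NonZero; suc; _*_; _/_)
open import Data.Nat.Primality using (Prime)
open import Data.Integer using (ℤ; +_)
open import Data.Integer.Divisibility using (_∣_)
open import Relation.Binary.PropositionalEquality using (_≡_; refl)
open import Relation.Nullary using (¬_)
open PairCount using (count-parity; p%4≡1⇒p≡4m+1)

theorem1p2 : (p : ℕ) → (pr : Prime p) → .{{_ : NonZero p}} → p % 4 ≡ 1 →
    (a : ℤ) → ¬ ((+ p) ∣ a) →
    (count1 a p + count2 a p) % 2 ≡ count3 a p % 2
theorem1p2 p pr p%4≡1 = at-4m+1 p (p / 4) (p%4≡1⇒p≡4m+1 p p%4≡1) pr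
  where
  at-4m+1 : ∀ p m → p ≡ suc (2 * (2 * m)) → (pr : Prime p) → .{{_ : NonZero p}} →
    (a : ℤ) → ¬ ((+ p) ∣ a) → (count1 a p + count2 a p) % 2 ≡ count3 a p % 2
  at-4m+1 .(suc (2 * (2 * m))) m refl pr = count-parity m pr
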